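{- The scalar product induces a bijection between equivalence classes of tame $SL_2(\mathbb{Z}[\sigma])$-tilings and pairs of bi-infinite paths in $\mathcal{T}$ considered up to the simultaneous action of $SL_2(\mathbb{Z}[\sigma])$ by $A$ on the first path and by $(A^T)^{ -1}$ on the second path ($A\in SL_2(\mathbb{Z}[\sigma])$). Here a pair of paths $(u_i),(v_j)$ is sent to the equivalence class of the tiling $(p_ir_j+q_is_j)_{i,j\in\mathbb{Z}}$, where $u_i=p_i/q_i$ and $v_j=r_j/s_j$ are any normalisations of the two paths.
   Context: Let $\sigma=e^{i\pi/3}$, $\mathbb{Z}[\sigma]$ the Eisenstein integers, $\widehat{\mathbb{Q}}(\sigma)=\mathbb{Q}(\sigma)\cup\{\infty\}$. A fraction $p/q$ ($p,q\in\mathbb{Z}[\sigma]$, not both zero) is irreducible if every common factor $k\in\mathbb{Z}[\sigma]$ of $p,q$ has $|k|=1$. $\mathcal{T}$ is the graph with vertex set $\widehat{\mathbb{Q}}(\sigma)$ in which points with irreducible representations $p/q$, $r/s$ are adjacent iff $|ps-rq|=1$. A bi-infinite path is a sequence $(v_i)_{i\in\mathbb{Z}}$ of vertices with $v_i,v_{i+1}$ adjacent; a normalisation of it is a choice of irreducible fractions $v_i=p_i/q_i$ with $p_iq_{i+1}-p_{i+1}q_i=1$ for all $i$ (any path has exactly six normalisations, differing by multiplying $p_i,q_i$ by $\sigma^{(-1)^ik}$). $SL_2(\mathbb{Z}[\sigma])$ acts on $\widehat{\mathbb{Q}}(\sigma)$ by Möbius transformations $z\mapsto\frac{az+b}{cz+d}$,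 preserving $\mathcal{T}$, hence acts on paths. A bi-infinite matrix $(m_{i,j})$ over $\mathbb{Z}[\sigma]$ is an $SL_2(\mathbb{Z}[\sigma])$-tiling if $m_{i,j}m_{i+1,j+1}-m_{i,j+1}m_{i+1,j}=1$ for all $i,j$, and tame if all $3\times3$ determinants $\det(m_{i+a,j+b})_{a,b=0,1,2}$ vanish. Two tilings $(m_{i,j})$, $(m'_{i,j})$ are equivalent if there are integers $k,l$ with $m'_{i,j}=\sigma^{(-1)^ik+(-1)^jl}m_{i,j}$ for all $i,j$. -}

module Defs where

open import Data.Integer as ℤ using (ℤ; +_; -[1+_]; 1ℤ; 0ℤ; ∣_∣)
open import Data.Nat as ℕ using (ℕ; zero; suc)
open import Data.Bool using (Bool; true; false; if_then_else_)
open import Data.Product using (Σ; ∃; _×_; _,_; proj₁; proj₂)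
open import Relation.Binary.PropositionalEquality using (_≡_)
open import Relation.Nullary using (¬_)

-- Eisenstein integers ℤ[σ], σ = e^{iπ/3}, σ² = σ - 1.
-- An element is  re + im · σ.

record ℤσ : Set where
  constructor _+_σ
  field
    re : ℤ
    im : ℤ
open ℤσ public

infixl 6 _⊕_ _⊖_
infixl 7 _⊗_

_⊕_ : ℤσ → ℤσ → ℤσ
(a + b σ) ⊕ (c + d σ) = (a ℤ.+ c) + (b ℤ.+ d) σ

⊝_ : ℤσ → ℤσ
⊝ (a + b σ) = (ℤ.- a) + (ℤ.- b) σ

_⊖_ : ℤσ → ℤσ → ℤσ
x ⊖ y = x ⊕ (⊝ y)

-- (a + bσ)(c + dσ) = ac + (ad + bc)σ + bd σ² = (ac - bd) + (ad + bc + bd)σ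
_⊗_ : ℤσ → ℤσ → ℤσ
(a + b σ) ⊗ (c + d σ) =
  (a ℤ.* c ℤ.- b ℤ.* d) + (a ℤ.* d ℤ.+ b ℤ.* c ℤ.+ b ℤ.* d) σ

𝟘 𝟙 σ σ⁻¹ : ℤσ
𝟘 = 0ℤ + 0ℤ σ
𝟙 = 1ℤ + 0ℤ σ
σ = 0ℤ + 1ℤ σ
σ⁻¹ = 1ℤ + (ℤ.- 1ℤ) σ

normSq : ℤσ → ℤ
normSq (a + b σ) = a ℤ.* a ℤ.+ a ℤ.* b ℤ.+ b ℤ.* b

HasAbs1 : ℤσ → Set
HasAbs1 k = normSq k ≡ 1ℤ

_∣σ_ : ℤσ → ℤσ → Set
k ∣σ p = ∃ λ t → p ≡ k ⊗ t

σ^ℕ : ℕ → ℤσ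
σ^ℕ zero = 𝟙
σ^ℕ (suc n) = σ ⊗ σ^ℕ n

σ⁻¹^ℕ : ℕ → ℤσ
σ⁻¹^ℕ zero = 𝟙
σ⁻¹^ℕ (suc n) = σ⁻¹ ⊗ σ⁻¹^ℕ n

σ^ : ℤ → ℤσ
σ^ (+ n) = σ^ℕ n
σ^ -[1+ n ] = σ⁻¹^ℕ (suc n)

evenℕ : ℕ → Bool
evenℕ zero = true
evenℕ (suc zero) = false
evenℕ (suc (suc n)) = evenℕ n

alt : ℤ → ℤ → ℤ
alt i k = if evenℕ ∣ i ∣ then k else ℤ.- k

-- A point of ℚ̂(σ) = ℚ(σ) ∪ {∞} is represented by a pair (p , q) of
-- Eisenstein integers, not both zero (the fraction p/q; q = 0 gives ∞);
-- two such pairs denote the same point iff p q' = p' q.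

Pair : Set
Pair = ℤσ × ℤσ

NotBothZero : Pair → Set
NotBothZero (p , q) = ¬ (p ≡ 𝟘 × q ≡ 𝟘)

record Vertex : Set where
  constructor vtx
  field
    frac    : Pair
    nonzero : NotBothZero frac
open Vertex public

SamePoint : Pair → Pair → Set
SamePoint (p , q) (p' , q') = p ⊗ q' ≡ p' ⊗ q

Irreducible : Pair → Set
Irreducible (p , q) =
  NotBothZero (p , q) × (∀ k → k ∣σ p → k ∣σ q → HasAbs1 k)

Represents : Pair → Vertex → Set
Represents pq x = Irreducible pq × SamePoint pq (frac x)

Adjacent : Vertex → Vertex → Set
Adjacent x y = ∃ λ pq → ∃ λ rs →
  Represents pq x × Represents rs y ×
  HasAbs1 (proj₁ pq ⊗ proj₂ rs ⊖ proj₁ rs ⊗ proj₂ pq)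

Seq : Set
Seq = ℤ → Vertex

IsPath : Seq → Set
IsPath v = ∀ i → Adjacent (v i) (v (i ℤ.+ 1ℤ))

record Normalisation (v : Seq) : Set where
  field
    num den : ℤ → ℤσ
    repr    : ∀ i → Represents (num i , den i) (v i)
    unimod  : ∀ i → num i ⊗ den (i ℤ.+ 1ℤ) ⊖ num (i ℤ.+ 1ℤ) ⊗ den i ≡ 𝟙
open Normalisation public

record SL₂ : Set where
  field
    a b c d : ℤσ
    det     : a ⊗ d ⊖ b ⊗ c ≡ 𝟙
open SL₂ public

-- Möbius action z ↦ (az + b)/(cz + d) on fractions
act : SL₂ → Pair → Pair
act A (p , q) = (a A ⊗ p ⊕ b A ⊗ q , c A ⊗ p ⊕ d A ⊗ q)

-- action of (Aᵀ)⁻¹ = [[d , -c] , [-b , a]]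
actInvT : SL₂ → Pair → Pair
actInvT A (p , q) = (d A ⊗ p ⊖ c A ⊗ q , ⊝ (b A) ⊗ p ⊕ a A ⊗ q)

PairEquiv : Seq → Seq → Seq → Seq → Set
PairEquiv u v u' v' = Σ SL₂ λ A →
  (∀ i → SamePoint (act A (frac (u i))) (frac (u' i))) ×
  (∀ j → SamePoint (actInvT A (frac (v j))) (frac (v' j)))

Matrix : Set
Matrix = ℤ → ℤ → ℤσ

IsSL₂Tiling : Matrix → Set
IsSL₂Tiling m = ∀ i j →
  m i j ⊗ m (i ℤ.+ 1ℤ) (j ℤ.+ 1ℤ) ⊖ m i (j ℤ.+ 1ℤ) ⊗ m (i ℤ.+ 1ℤ) j ≡ 𝟙

det3 : (ℤσ × ℤσ × ℤσ) → (ℤσ × ℤσ × ℤσ) → (ℤσ × ℤσ × ℤσ) → ℤσ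
det3 (x₁ , x₂ , x₃) (y₁ , y₂ , y₃) (z₁ , z₂ , z₃) =
  x₁ ⊗ (y₂ ⊗ z₃ ⊖ y₃ ⊗ z₂) ⊖ x₂ ⊗ (y₁ ⊗ z₃ ⊖ y₃ ⊗ z₁)
    ⊕ x₃ ⊗ (y₁ ⊗ z₂ ⊖ y₂ ⊗ z₁)

row3 : Matrix → ℤ → ℤ → ℤσ × ℤσ × ℤσ
row3 m i j = (m i j , m i (j ℤ.+ 1ℤ) , m i (j ℤ.+ 1ℤ ℤ.+ 1ℤ))

IsTame : Matrix → Set
IsTame m = ∀ i j →
  det3 (row3 m i j) (row3 m (i ℤ.+ 1ℤ) j) (row3 m (i ℤ.+ 1ℤ ℤ.+ 1ℤ) j) ≡ 𝟘

IsTameSL₂Tiling : Matrix → Set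
IsTameSL₂Tiling m = IsSL₂Tiling m × IsTame m

TilingEquiv : Matrix → Matrix → Set
TilingEquiv m m' = ∃ λ k → ∃ λ l → ∀ i j →
  m' i j ≡ σ^ (alt i k ℤ.+ alt j l) ⊗ m i j

scalar : {u v : Seq} → Normalisation u → Normalisation v → Matrix
scalar nu nv i j = num nu i ⊗ num nv j ⊕ den nu i ⊗ den nv j

{-# OPTIONS --safe #-}
-- A normalised path is a sequence of vectors xᵢ ∈ ℤ[σ]² with det(xᵢ , xᵢ₊₁) = 1.  By Cauchy–Binet the
-- matrix of scalar products xᵢ · yⱼ of two such sequences is an SL₂-tiling, and it is tame because it has
-- rank 2.  Every path has a normalisation, built edge by edge from representatives of adjacent vertices
-- with unit determinant; two normalisations of a path differ by factors σ^(±k) alternating along the path,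
-- as the units of ℤ[σ] are the powers of σ.  Moving both paths by A and (Aᵀ)⁻¹ preserves scalar products,
-- so the tiling class is well defined; conversely, since x₀, x₁ and y₀, y₁ are bases, equal scalar products
-- force x′ = A x and y′ = (Aᵀ)⁻¹ y for one A ∈ SL₂.  Finally, a tame SL₂-tiling m equals xᵢ · yⱼ where
-- x is read off its first two columns and y, by Cramer's rule, off its first two rows: in a tame SL₂-tiling
-- every row is determined by the two rows before it, through a recurrence whose coefficient only depends on
-- the first two columns.
module Submission where

open import Defs
open import Data.Product using (Σ; ∃; _×_; _,_; proj₁; proj₂)

open import Algebra.Bundles using (CommutativeRing)
open import Algebra.Structures using (IsCommutativeRing)
import Algebra.Properties.Group as GroupProperties
open import Data.Bool using (true; false; not)
open import Data.Bool.Properties using (not-involutive)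
open import Data.Empty using (⊥-elim)
open import Data.Integer as ℤ using (ℤ; +_; -[1+_]; 0ℤ; 1ℤ; ∣_∣)
import Data.Integer.Properties as ℤP
import Data.Integer.Tactic.RingSolver as ℤ-Solver
open import Data.List using ([]; _∷_)
open import Data.Maybe using (just; nothing)
open import Data.Nat as ℕ using (zero; suc; _≤_; z≤n; s≤s)
import Data.Nat.Properties as ℕP
import Data.Nat.Tactic.RingSolver as ℕ-Solver
open import Data.Sum as Sum using (_⊎_; inj₁; inj₂)
open import Data.Unit using (⊤; tt)
open import Function using (case_of_)
open import Relation.Binary.PropositionalEquality
open import Tactic.RingSolver using (solve-∀; solve)
open import Tactic.RingSolver.Core.AlmostCommutativeRing using (AlmostCommutativeRing; fromCommutativeRing)

open ≡-Reasoning

-- The ring ℤ[σ] and its units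

⊕-assoc : ∀ x y z → (x ⊕ y) ⊕ z ≡ x ⊕ (y ⊕ z)
⊕-assoc (a + b σ) (c + d σ) (e + f σ) = cong₂ _+_σ (ℤP.+-assoc a c e) (ℤP.+-assoc b d f)

⊕-comm : ∀ x y → x ⊕ y ≡ y ⊕ x
⊕-comm (a + b σ) (c + d σ) = cong₂ _+_σ (ℤP.+-comm a c) (ℤP.+-comm b d)

⊕-identityˡ : ∀ x → 𝟘 ⊕ x ≡ x
⊕-identityˡ (a + b σ) = cong₂ _+_σ (ℤP.+-identityˡ a) (ℤP.+-identityˡ b)

⊕-identityʳ : ∀ x → x ⊕ 𝟘 ≡ x
⊕-identityʳ x = trans (⊕-comm x 𝟘) (⊕-identityˡ x)

⊝-inverseˡ : ∀ x → (⊝ x) ⊕ x ≡ 𝟘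
⊝-inverseˡ (a + b σ) = cong₂ _+_σ (ℤP.+-inverseˡ a) (ℤP.+-inverseˡ b)

⊝-inverseʳ : ∀ x → x ⊕ (⊝ x) ≡ 𝟘
⊝-inverseʳ x = trans (⊕-comm x (⊝ x)) (⊝-inverseˡ x)

⊗-assoc : ∀ x y z → (x ⊗ y) ⊗ z ≡ x ⊗ (y ⊗ z)
⊗-assoc (a + b σ) (c + d σ) (e + f σ) = cong₂ _+_σ (real a b c d e f) (imag a b c d e f)
  where
  open import Data.Integer using (_+_; _*_; _-_)
  real : ∀ a b c d e f → (a * c - b * d) * e - (a * d + b * c + b * d) * f
                     ≡ a * (c * e - d * f) - b * (c * f + d * e + d * f)
  real = ℤ-Solver.solve-∀
  imag : ∀ a b c d e f → (a * c - b * d) * f + (a * d + b * c + b * d) * e + (a * d + b * c + b * d) * f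
                     ≡ a * (c * f + d * e + d * f) + b * (c * e - d * f) + b * (c * f + d * e + d * f)
  imag = ℤ-Solver.solve-∀

⊗-comm : ∀ x y → x ⊗ y ≡ y ⊗ x
⊗-comm (a + b σ) (c + d σ) = cong₂ _+_σ (real a b c d) (imag a b c d)
  where
  open import Data.Integer using (_+_; _*_; _-_)
  real : ∀ a b c d → a * c - b * d ≡ c * a - d * b
  real = ℤ-Solver.solve-∀
  imag : ∀ a b c d → a * d + b * c + b * d ≡ c * b + d * a + d * b
  imag = ℤ-Solver.solve-∀

⊗-identityˡ : ∀ x → 𝟙 ⊗ x ≡ x
⊗-identityˡ (a + b σ) = cong₂ _+_σ (real a b) (imag a b)
  where
  open import Data.Integer using (_+_; _*_; _-_)
  real : ∀ a b → 1ℤ * a - 0ℤ * b ≡ a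
  real = ℤ-Solver.solve-∀
  imag : ∀ a b → 1ℤ * b + 0ℤ * a + 0ℤ * b ≡ b
  imag = ℤ-Solver.solve-∀

⊗-identityʳ : ∀ x → x ⊗ 𝟙 ≡ x
⊗-identityʳ x = trans (⊗-comm x 𝟙) (⊗-identityˡ x)

⊗-distribˡ-⊕ : ∀ x y z → x ⊗ (y ⊕ z) ≡ x ⊗ y ⊕ x ⊗ z
⊗-distribˡ-⊕ (a + b σ) (c + d σ) (e + f σ) = cong₂ _+_σ (real a b c d e f) (imag a b c d e f)
  where
  open import Data.Integer using (_+_; _*_; _-_)
  real : ∀ a b c d e f → a * (c + e) - b * (d + f) ≡ (a * c - b * d) + (a * e - b * f)
  real = ℤ-Solver.solve-∀
  imag : ∀ a b c d e f → a * (d + f) + b * (c + e) + b * (d + f)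
                     ≡ (a * d + b * c + b * d) + (a * f + b * e + b * f)
  imag = ℤ-Solver.solve-∀

⊗-distribʳ-⊕ : ∀ x y z → (y ⊕ z) ⊗ x ≡ y ⊗ x ⊕ z ⊗ x
⊗-distribʳ-⊕ x y z = begin
  (y ⊕ z) ⊗ x     ≡⟨ ⊗-comm (y ⊕ z) x ⟩
  x ⊗ (y ⊕ z)     ≡⟨ ⊗-distribˡ-⊕ x y z ⟩
  x ⊗ y ⊕ x ⊗ z   ≡⟨ cong₂ _⊕_ (⊗-comm x y) (⊗-comm x z) ⟩
  y ⊗ x ⊕ z ⊗ x   ∎

ℤσ-isCommutativeRing : IsCommutativeRing _≡_ _⊕_ _⊗_ ⊝_ 𝟘 𝟙
ℤσ-isCommutativeRing = record
  { isRing = record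
    { +-isAbelianGroup = record
      { isGroup = record
        { isMonoid = record
          { isSemigroup = record
            { isMagma = record { isEquivalence = isEquivalence ; ∙-cong = cong₂ _⊕_ }
            ; assoc = ⊕-assoc }
          ; identity = ⊕-identityˡ , ⊕-identityʳ }
        ; inverse = ⊝-inverseˡ , ⊝-inverseʳ
        ; ⁻¹-cong = cong ⊝_ }
      ; comm = ⊕-comm }
    ; *-cong = cong₂ _⊗_
    ; *-assoc = ⊗-assoc
    ; *-identity = ⊗-identityˡ , ⊗-identityʳ
    ; distrib = ⊗-distribˡ-⊕ , ⊗-distribʳ-⊕ }
  ; *-comm = ⊗-comm }

ℤσ-commutativeRing : CommutativeRing _ _
ℤσ-commutativeRing = record { isCommutativeRing = ℤσ-isCommutativeRing }

ℤσ-ring : AlmostCommutativeRing _ _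
ℤσ-ring = fromCommutativeRing ℤσ-commutativeRing λ { ((+ 0) + (+ 0) σ) → just refl ; _ → nothing }

open GroupProperties (CommutativeRing.+-group ℤσ-commutativeRing)
  using () renaming (x∙y⁻¹≈ε⇒x≈y to x⊖y≡𝟘⇒x≡y; x≈y⇒x∙y⁻¹≈ε to x≡y⇒x⊖y≡𝟘)

𝟘≢𝟙 : 𝟘 ≢ 𝟙
𝟘≢𝟙 ()

inverse-unique : ∀ x y z → x ⊗ y ≡ 𝟙 → x ⊗ z ≡ 𝟙 → y ≡ z
inverse-unique x y z xy≡1 xz≡1 = begin
  y                                   ≡⟨ solve (x ∷ y ∷ z ∷ []) ℤσ-ring ⟩
  z ⊗ (x ⊗ y) ⊕ y ⊗ (𝟙 ⊖ x ⊗ z)       ≡⟨ cong₂ (λ s t → z ⊗ s ⊕ y ⊗ (𝟙 ⊖ t)) xy≡1 xz≡1 ⟩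
  z ⊗ 𝟙 ⊕ y ⊗ (𝟙 ⊖ 𝟙)                 ≡⟨ solve (y ∷ z ∷ []) ℤσ-ring ⟩
  z                                   ∎

cancel-𝟙 : ∀ {x y u} → x ≡ y ⊗ u → u ≡ 𝟙 → x ≡ y
cancel-𝟙 {y = y} x≡yu u≡𝟙 = trans x≡yu (trans (cong (y ⊗_) u≡𝟙) (⊗-identityʳ y))

normSq-⊗ : ∀ x y → normSq (x ⊗ y) ≡ normSq x ℤ.* normSq y
normSq-⊗ (a + b σ) (c + d σ) = identity a b c d
  where
  open import Data.Integer using (_+_; _*_; _-_)
  identity : ∀ a b c d →
    (a * c - b * d) * (a * c - b * d) + (a * c - b * d) * (a * d + b * c + b * d)
      + (a * d + b * c + b * d) * (a * d + b * c + b * d)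
    ≡ (a * a + a * b + b * b) * (c * c + c * d + d * d)
  identity = ℤ-Solver.solve-∀

normSq-swap : ∀ a b → normSq (a + b σ) ≡ normSq (b + a σ)
normSq-swap = identity
  where
  open import Data.Integer using (_+_; _*_)
  identity : ∀ a b → a * a + a * b + b * b ≡ b * b + b * a + a * a
  identity = ℤ-Solver.solve-∀

-- k = ∣2a + b∣², since 4 (a² + ab + b²) = (2a + b)² + 3b²
four-normSq : ∀ a b → ∃ λ k → + 4 ℤ.* normSq (a + b σ) ≡ + (k ℕ.+ 3 ℕ.* (∣ b ∣ ℕ.* ∣ b ∣))
four-normSq a b = ∣ t ∣ ℕ.* ∣ t ∣ , (begin
  + 4 ℤ.* normSq (a + b σ)                     ≡⟨ identity a b ⟩
  t ℤ.* t ℤ.+ + 3 ℤ.* (b ℤ.* b)                ≡⟨ cong₂ (λ u v → u ℤ.+ + 3 ℤ.* v) (square t) (square b) ⟩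
  + (∣ t ∣ ℕ.* ∣ t ∣) ℤ.+ + 3 ℤ.* + (∣ b ∣ ℕ.* ∣ b ∣)
    ≡⟨ cong (ℤ._+_ (+ (∣ t ∣ ℕ.* ∣ t ∣))) (sym (ℤP.pos-* 3 (∣ b ∣ ℕ.* ∣ b ∣))) ⟩
  + (∣ t ∣ ℕ.* ∣ t ∣) ℤ.+ + (3 ℕ.* (∣ b ∣ ℕ.* ∣ b ∣))
    ≡⟨ sym (ℤP.pos-+ (∣ t ∣ ℕ.* ∣ t ∣) (3 ℕ.* (∣ b ∣ ℕ.* ∣ b ∣))) ⟩
  + (∣ t ∣ ℕ.* ∣ t ∣ ℕ.+ 3 ℕ.* (∣ b ∣ ℕ.* ∣ b ∣)) ∎)
  where
  t : ℤ
  t = + 2 ℤ.* a ℤ.+ b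
  identity : ∀ a b → + 4 ℤ.* (a ℤ.* a ℤ.+ a ℤ.* b ℤ.+ b ℤ.* b)
                   ≡ (+ 2 ℤ.* a ℤ.+ b) ℤ.* (+ 2 ℤ.* a ℤ.+ b) ℤ.+ + 3 ℤ.* (b ℤ.* b)
  identity = ℤ-Solver.solve-∀
  square : ∀ i → i ℤ.* i ≡ + (∣ i ∣ ℕ.* ∣ i ∣)
  square (+ n) = sym (ℤP.pos-* n n)
  square -[1+ n ] = refl

normSq-nonneg : ∀ x → ∃ λ n → normSq x ≡ + n
normSq-nonneg (a + b σ) with normSq (a + b σ) | four-normSq a b
... | + n | _ = n , refl
... | -[1+ n ] | _ , ()

normSq≡0⇒im≡0 : ∀ a b → normSq (a + b σ) ≡ 0ℤ → b ≡ 0ℤ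
normSq≡0⇒im≡0 a b N≡0 with four-normSq a b
... | k , eq = ℤP.∣i∣≡0⇒i≡0 (square-zero ∣ b ∣ (ℕP.m+n≡0⇒n≡0 k
                 (ℤP.+-injective (trans (sym eq) (cong (+ 4 ℤ.*_) N≡0)))))
  where
  square-zero : ∀ n → 3 ℕ.* (n ℕ.* n) ≡ 0 → n ≡ 0
  square-zero zero _ = refl

normSq≡0⇒≡𝟘 : ∀ x → normSq x ≡ 0ℤ → x ≡ 𝟘
normSq≡0⇒≡𝟘 (a + b σ) N≡0 =
  cong₂ _+_σ (normSq≡0⇒im≡0 b a (trans (normSq-swap b a) N≡0)) (normSq≡0⇒im≡0 a b N≡0)

normSq≡1⇒∣im∣≤1 : ∀ a b → normSq (a + b σ) ≡ 1ℤ → ∣ b ∣ ≤ 1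
normSq≡1⇒∣im∣≤1 a b N≡1 with four-normSq a b
... | k , eq = bound k ∣ b ∣ (sym (ℤP.+-injective (trans (sym (cong (+ 4 ℤ.*_) N≡1)) eq)))
  where
  expand : ∀ k n → 12 ℕ.+ (k ℕ.+ 3 ℕ.* (n ℕ.* n) ℕ.+ 12 ℕ.* n) ≡ k ℕ.+ 3 ℕ.* ((2 ℕ.+ n) ℕ.* (2 ℕ.+ n))
  expand = ℕ-Solver.solve-∀
  bound : ∀ k n → k ℕ.+ 3 ℕ.* (n ℕ.* n) ≡ 4 → n ≤ 1
  bound k 0 _ = z≤n
  bound k 1 _ = s≤s z≤n
  bound k (suc (suc n)) eq = case trans (expand k n) eq of λ ()

-- By four-normSq and the symmetry a ↔ b, both ∣a∣ and ∣b∣ are at most 1, which leaves nine cases.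
HasAbs1⇒σ^ℕ : ∀ x → HasAbs1 x → ∃ λ k → x ≡ σ^ℕ k
HasAbs1⇒σ^ℕ (a + b σ) N≡1 =
  unit a b (normSq≡1⇒∣im∣≤1 b a (trans (normSq-swap b a) N≡1)) (normSq≡1⇒∣im∣≤1 a b N≡1) N≡1
  where
  unit : ∀ a b → ∣ a ∣ ≤ 1 → ∣ b ∣ ≤ 1 → normSq (a + b σ) ≡ 1ℤ → ∃ λ k → a + b σ ≡ σ^ℕ k
  unit (+ 0)      (+ 0)      _ _ ()
  unit (+ 0)      (+ 1)      _ _ _ = 1 , refl
  unit (+ 0)      -[1+ 0 ]   _ _ _ = 4 , refl
  unit (+ 1)      (+ 0)      _ _ _ = 0 , refl
  unit (+ 1)      (+ 1)      _ _ ()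
  unit (+ 1)      -[1+ 0 ]   _ _ _ = 5 , refl
  unit -[1+ 0 ]   (+ 0)      _ _ _ = 3 , refl
  unit -[1+ 0 ]   (+ 1)      _ _ _ = 2 , refl
  unit -[1+ 0 ]   -[1+ 0 ]   _ _ ()
  unit (+ suc (suc _)) _ (s≤s ()) _ _
  unit -[1+ suc _ ]    _ (s≤s ()) _ _
  unit _ (+ suc (suc _)) _ (s≤s ()) _
  unit _ -[1+ suc _ ]    _ (s≤s ()) _

x⊗y≡𝟙⇒HasAbs1 : ∀ x y → x ⊗ y ≡ 𝟙 → HasAbs1 x
x⊗y≡𝟙⇒HasAbs1 x y xy≡1 with normSq-nonneg x | normSq-nonneg y
... | m , Nx≡m | n , Ny≡n = trans Nx≡m (cong +_ (ℕP.m*n≡1⇒m≡1 m n (ℤP.+-injective (begin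
  + (m ℕ.* n)             ≡⟨ ℤP.pos-* m n ⟩
  + m ℤ.* + n             ≡⟨ cong₂ ℤ._*_ (sym Nx≡m) (sym Ny≡n) ⟩
  normSq x ℤ.* normSq y   ≡⟨ sym (normSq-⊗ x y) ⟩
  normSq (x ⊗ y)          ≡⟨ cong normSq xy≡1 ⟩
  1ℤ                      ∎))))

x⊗y≡𝟘⇒x≡𝟘∨y≡𝟘 : ∀ x y → x ⊗ y ≡ 𝟘 → x ≡ 𝟘 ⊎ y ≡ 𝟘
x⊗y≡𝟘⇒x≡𝟘∨y≡𝟘 x y xy≡0 = Sum.map (normSq≡0⇒≡𝟘 x) (normSq≡0⇒≡𝟘 y)
  (ℤP.i*j≡0⇒i≡0∨j≡0 (normSq x) (trans (sym (normSq-⊗ x y)) (cong normSq xy≡0)))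

conj : ℤσ → ℤσ
conj (a + b σ) = (a ℤ.+ b) + (ℤ.- b) σ

HasAbs1⇒⊗-conj≡𝟙 : ∀ x → HasAbs1 x → x ⊗ conj x ≡ 𝟙
HasAbs1⇒⊗-conj≡𝟙 (a + b σ) N≡1 = cong₂ _+_σ (trans (real a b) N≡1) (imag a b)
  where
  open import Data.Integer using (_+_; _*_; _-_; -_)
  real : ∀ a b → a * (a + b) - b * (- b) ≡ a * a + a * b + b * b
  real = ℤ-Solver.solve-∀
  imag : ∀ a b → a * (- b) + b * (a + b) + b * (- b) ≡ 0ℤ
  imag = ℤ-Solver.solve-∀

σ^ℕ-+ : ∀ m n → σ^ℕ (m ℕ.+ n) ≡ σ^ℕ m ⊗ σ^ℕ n
σ^ℕ-+ zero    n = sym (⊗-identityˡ (σ^ℕ n))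
σ^ℕ-+ (suc m) n = trans (cong (σ ⊗_) (σ^ℕ-+ m n)) (sym (⊗-assoc σ (σ^ℕ m) (σ^ℕ n)))

σ⁻¹^ℕ-+ : ∀ m n → σ⁻¹^ℕ (m ℕ.+ n) ≡ σ⁻¹^ℕ m ⊗ σ⁻¹^ℕ n
σ⁻¹^ℕ-+ zero    n = sym (⊗-identityˡ (σ⁻¹^ℕ n))
σ⁻¹^ℕ-+ (suc m) n = trans (cong (σ⁻¹ ⊗_) (σ⁻¹^ℕ-+ m n)) (sym (⊗-assoc σ⁻¹ (σ⁻¹^ℕ m) (σ⁻¹^ℕ n)))

σ^-⊖ : ∀ m n → σ^ (m ℤ.⊖ n) ≡ σ^ℕ m ⊗ σ⁻¹^ℕ n
σ^-⊖ m       zero    = sym (⊗-identityʳ (σ^ℕ m))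
σ^-⊖ zero    (suc n) = sym (⊗-identityˡ (σ⁻¹^ℕ (suc n)))
σ^-⊖ (suc m) (suc n) = begin
  σ^ (suc m ℤ.⊖ suc n)               ≡⟨ cong σ^ (ℤP.[1+m]⊖[1+n]≡m⊖n m n) ⟩
  σ^ (m ℤ.⊖ n)                       ≡⟨ σ^-⊖ m n ⟩
  σ^ℕ m ⊗ σ⁻¹^ℕ n                   ≡⟨ σσ⁻¹-cancel (σ^ℕ m) (σ⁻¹^ℕ n) ⟩
  (σ ⊗ σ^ℕ m) ⊗ (σ⁻¹ ⊗ σ⁻¹^ℕ n)      ∎
  where
  σσ⁻¹-cancel : ∀ s t → s ⊗ t ≡ (σ ⊗ s) ⊗ (σ⁻¹ ⊗ t)
  σσ⁻¹-cancel = solve-∀ ℤσ-ring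

σ^-+ : ∀ i j → σ^ (i ℤ.+ j) ≡ σ^ i ⊗ σ^ j
σ^-+ (+ m)    (+ n)    = σ^ℕ-+ m n
σ^-+ (+ m)    -[1+ n ] = σ^-⊖ m (suc n)
σ^-+ -[1+ m ] (+ n)    = trans (σ^-⊖ n (suc m)) (⊗-comm (σ^ℕ n) (σ⁻¹^ℕ (suc m)))
σ^-+ -[1+ m ] -[1+ n ] = trans (cong (λ k → σ⁻¹^ℕ (suc k)) (sym (ℕP.+-suc m n))) (σ⁻¹^ℕ-+ (suc m) (suc n))

σ^-inverse : ∀ i → σ^ i ⊗ σ^ (ℤ.- i) ≡ 𝟙
σ^-inverse i = trans (sym (σ^-+ i (ℤ.- i))) (cong σ^ (ℤP.+-inverseʳ i))

evenℕ-suc : ∀ n → evenℕ (suc n) ≡ not (evenℕ n)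
evenℕ-suc zero    = refl
evenℕ-suc (suc n) = trans (sym (not-involutive (evenℕ n))) (cong not (sym (evenℕ-suc n)))

evenℕ-∣i+1∣ : ∀ i → evenℕ ∣ i ℤ.+ 1ℤ ∣ ≡ not (evenℕ ∣ i ∣)
evenℕ-∣i+1∣ (+ n)           = trans (cong evenℕ (ℕP.+-comm n 1)) (evenℕ-suc n)
evenℕ-∣i+1∣ -[1+ zero ]     = refl
evenℕ-∣i+1∣ -[1+ suc n ]    = evenℕ-suc n

alt-suc : ∀ i k → alt (i ℤ.+ 1ℤ) k ≡ ℤ.- alt i k
alt-suc i k rewrite evenℕ-∣i+1∣ i with evenℕ ∣ i ∣
... | true  = refl
... | false = sym (ℤP.neg-involutive k)

alt-zero : ∀ i → alt i 0ℤ ≡ 0ℤ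
alt-zero i with evenℕ ∣ i ∣
... | true  = refl
... | false = refl

σ^alt-inverse : ∀ i k → σ^ (alt i k) ⊗ σ^ (alt (i ℤ.+ 1ℤ) k) ≡ 𝟙
σ^alt-inverse i k = trans (cong (λ t → σ^ (alt i k) ⊗ σ^ t) (alt-suc i k)) (σ^-inverse (alt i k))

-- Recursion over ℤ

module _ {S : ℤ → Set} (R : ∀ i → S i → S (i ℤ.+ 1ℤ) → Set) (s₀ : S 0ℤ)
         (next : ∀ i (s : S i) → Σ (S (i ℤ.+ 1ℤ)) (R i s))
         (previous : ∀ i (s : S (i ℤ.+ 1ℤ)) → Σ (S i) λ s′ → R i s′ s) where

  private
    +n+1≡+[1+n] : ∀ n → + n ℤ.+ 1ℤ ≡ + suc n
    +n+1≡+[1+n] n = cong +_ (ℕP.+-comm n 1)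

  chain : ∀ i → S i
  chain (+ zero)       = s₀
  chain (+ suc n)      = subst S (+n+1≡+[1+n] n) (proj₁ (next (+ n) (chain (+ n))))
  chain -[1+ zero ]    = proj₁ (previous -[1+ zero ] s₀)
  chain -[1+ suc n ]   = proj₁ (previous -[1+ suc n ] (chain -[1+ n ]))

  chain-related : ∀ i → R i (chain i) (chain (i ℤ.+ 1ℤ))
  -- + n ℤ.+ 1ℤ is not definitionally + suc n, so the step taken at + n has to be transported back.
  chain-related (+ n)        = subst (R (+ n) (chain (+ n))) (sym (unsubst (+n+1≡+[1+n] n) refl))
                                 (proj₂ (next (+ n) (chain (+ n))))
    where
    unsubst : ∀ {i j} (e : i ≡ j) {s : S i} → chain j ≡ subst S e s → chain i ≡ s
    unsubst refl eq = eq
  chain-related -[1+ zero ]  = proj₂ (previous -[1+ zero ] s₀)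
  chain-related -[1+ suc n ] = proj₂ (previous -[1+ suc n ] (chain -[1+ n ]))

ℤ-induction : {P : ℤ → Set} → P 0ℤ → (∀ i → P i → P (i ℤ.+ 1ℤ)) → (∀ i → P (i ℤ.+ 1ℤ) → P i) → ∀ i → P i
ℤ-induction {P} p₀ suc-step pred-step =
  chain {S = P} (λ _ _ _ → ⊤) p₀ (λ i p → suc-step i p , tt) (λ i p → pred-step i p , tt)

ℤ-induction₂ : {P : ℤ → Set} → P 0ℤ → P 1ℤ →
               (∀ i → P i → P (i ℤ.+ 1ℤ) → P (i ℤ.+ 1ℤ ℤ.+ 1ℤ)) →
               (∀ i → P (i ℤ.+ 1ℤ) → P (i ℤ.+ 1ℤ ℤ.+ 1ℤ) → P i) → ∀ i → P i
ℤ-induction₂ {P} p₀ p₁ suc-step pred-step i =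
  proj₁ (ℤ-induction {λ i → P i × P (i ℤ.+ 1ℤ)} (p₀ , p₁)
           (λ i (p , p′) → p′ , suc-step i p p′) (λ i (p′ , p″) → pred-step i p′ p″ , p′) i)

-- Vectors in ℤ[σ]²

infixl 7 _*ₗ_

_·_ : Pair → Pair → ℤσ
(p , q) · (r , s) = p ⊗ r ⊕ q ⊗ s

det2 : Pair → Pair → ℤσ
det2 (p , q) (r , s) = p ⊗ s ⊖ r ⊗ q

_*ₗ_ : ℤσ → Pair → Pair
c *ₗ (p , q) = c ⊗ p , c ⊗ q

Unimodular : (ℤ → Pair) → Set
Unimodular x = ∀ i → det2 (x i) (x (i ℤ.+ 1ℤ)) ≡ 𝟙

det2-*ₗ : ∀ c d x y → det2 (c *ₗ x) (d *ₗ y) ≡ (c ⊗ d) ⊗ det2 x y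
det2-*ₗ c d (p , q) (r , s) = identity c d p q r s
  where
  identity : ∀ c d p q r s → (c ⊗ p) ⊗ (d ⊗ s) ⊖ (d ⊗ r) ⊗ (c ⊗ q) ≡ (c ⊗ d) ⊗ (p ⊗ s ⊖ r ⊗ q)
  identity = solve-∀ ℤσ-ring

det2-*ₗˡ : ∀ c x y → det2 (c *ₗ x) y ≡ c ⊗ det2 x y
det2-*ₗˡ c (p , q) (r , s) = identity c p q r s
  where
  identity : ∀ c p q r s → (c ⊗ p) ⊗ s ⊖ r ⊗ (c ⊗ q) ≡ c ⊗ (p ⊗ s ⊖ r ⊗ q)
  identity = solve-∀ ℤσ-ring

det2-*ₗʳ : ∀ c x y → det2 x (c *ₗ y) ≡ c ⊗ det2 x y
det2-*ₗʳ c (p , q) (r , s) = identity c p q r s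
  where
  identity : ∀ c p q r s → p ⊗ (c ⊗ s) ⊖ (c ⊗ r) ⊗ q ≡ c ⊗ (p ⊗ s ⊖ r ⊗ q)
  identity = solve-∀ ℤσ-ring

·-*ₗ : ∀ c d x y → (c *ₗ x) · (d *ₗ y) ≡ (c ⊗ d) ⊗ (x · y)
·-*ₗ c d (p , q) (r , s) = identity c d p q r s
  where
  identity : ∀ c d p q r s → (c ⊗ p) ⊗ (d ⊗ r) ⊕ (c ⊗ q) ⊗ (d ⊗ s) ≡ (c ⊗ d) ⊗ (p ⊗ r ⊕ q ⊗ s)
  identity = solve-∀ ℤσ-ring

det2-cauchyBinet : ∀ x x′ y y′ → (x · y) ⊗ (x′ · y′) ⊖ (x · y′) ⊗ (x′ · y) ≡ det2 x x′ ⊗ det2 y y′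
det2-cauchyBinet (p , q) (p′ , q′) (r , s) (r′ , s′) = identity p q p′ q′ r s r′ s′
  where
  identity : ∀ p q p′ q′ r s r′ s′ →
    (p ⊗ r ⊕ q ⊗ s) ⊗ (p′ ⊗ r′ ⊕ q′ ⊗ s′) ⊖ (p ⊗ r′ ⊕ q ⊗ s′) ⊗ (p′ ⊗ r ⊕ q′ ⊗ s)
    ≡ (p ⊗ q′ ⊖ p′ ⊗ q) ⊗ (r ⊗ s′ ⊖ r′ ⊗ s)
  identity = solve-∀ ℤσ-ring

SamePoint⇒det2≡𝟘 : ∀ x y → SamePoint x y → det2 x y ≡ 𝟘
SamePoint⇒det2≡𝟘 _ _ = x≡y⇒x⊖y≡𝟘

det2≡𝟘⇒SamePoint : ∀ x y → det2 x y ≡ 𝟘 → SamePoint x y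
det2≡𝟘⇒SamePoint x y = x⊖y≡𝟘⇒x≡y (proj₁ x ⊗ proj₂ y) (proj₁ y ⊗ proj₂ x)

SamePoint-sym : ∀ x y → SamePoint x y → SamePoint y x
SamePoint-sym _ _ = sym

-- det2 x z ⊗ y vanishes componentwise, and y ≠ 0 in the integral domain ℤ[σ].
SamePoint-trans : ∀ x y z → NotBothZero y → SamePoint x y → SamePoint y z → SamePoint x z
SamePoint-trans x@(p , q) y@(p′ , q′) z@(p″ , q″) y≢𝟘 x∼y y∼z =
  det2≡𝟘⇒SamePoint x z (cancel (x⊗y≡𝟘⇒x≡𝟘∨y≡𝟘 D q′ Dq′≡𝟘) (x⊗y≡𝟘⇒x≡𝟘∨y≡𝟘 D p′ Dp′≡𝟘))
  where
  D : ℤσ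
  D = det2 x z
  Dq′≡𝟘 : D ⊗ q′ ≡ 𝟘
  Dq′≡𝟘 = begin
    (p ⊗ q″ ⊖ p″ ⊗ q) ⊗ q′                              ≡⟨ solve (p ∷ q ∷ p′ ∷ q′ ∷ p″ ∷ q″ ∷ []) ℤσ-ring ⟩
    q″ ⊗ (p ⊗ q′ ⊖ p′ ⊗ q) ⊕ q ⊗ (p′ ⊗ q″ ⊖ p″ ⊗ q′)   ≡⟨ cong₂ (λ s t → q″ ⊗ s ⊕ q ⊗ t)
                                                            (SamePoint⇒det2≡𝟘 x y x∼y) (SamePoint⇒det2≡𝟘 y z y∼z) ⟩
    q″ ⊗ 𝟘 ⊕ q ⊗ 𝟘                                      ≡⟨ solve (q ∷ q″ ∷ []) ℤσ-ring ⟩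
    𝟘                                                    ∎
  Dp′≡𝟘 : D ⊗ p′ ≡ 𝟘
  Dp′≡𝟘 = begin
    (p ⊗ q″ ⊖ p″ ⊗ q) ⊗ p′                              ≡⟨ solve (p ∷ q ∷ p′ ∷ q′ ∷ p″ ∷ q″ ∷ []) ℤσ-ring ⟩
    p ⊗ (p′ ⊗ q″ ⊖ p″ ⊗ q′) ⊕ p″ ⊗ (p ⊗ q′ ⊖ p′ ⊗ q)   ≡⟨ cong₂ (λ s t → p ⊗ s ⊕ p″ ⊗ t)
                                                            (SamePoint⇒det2≡𝟘 y z y∼z) (SamePoint⇒det2≡𝟘 x y x∼y) ⟩
    p ⊗ 𝟘 ⊕ p″ ⊗ 𝟘                                      ≡⟨ solve (p ∷ p″ ∷ []) ℤσ-ring ⟩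
    𝟘                                                    ∎
  cancel : D ≡ 𝟘 ⊎ q′ ≡ 𝟘 → D ≡ 𝟘 ⊎ p′ ≡ 𝟘 → D ≡ 𝟘
  cancel (inj₁ D≡𝟘)  _              = D≡𝟘
  cancel (inj₂ _)    (inj₁ D≡𝟘)     = D≡𝟘
  cancel (inj₂ q′≡𝟘) (inj₂ p′≡𝟘)    = ⊥-elim (y≢𝟘 (p′≡𝟘 , q′≡𝟘))

SamePoint-*ₗ : ∀ c x y → SamePoint x y → SamePoint (c *ₗ x) y
SamePoint-*ₗ c (p , q) (r , s) p∼r = begin
  (c ⊗ p) ⊗ s   ≡⟨ ⊗-assoc c p s ⟩
  c ⊗ (p ⊗ s)   ≡⟨ cong (c ⊗_) p∼r ⟩
  c ⊗ (r ⊗ q)   ≡⟨ solve (c ∷ q ∷ r ∷ []) ℤσ-ring ⟩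
  r ⊗ (c ⊗ q)   ∎

det2-swap : ∀ x y → det2 y (⊝ 𝟙 *ₗ x) ≡ det2 x y
det2-swap (p , q) (r , s) = identity p q r s
  where
  identity : ∀ p q r s → r ⊗ (⊝ 𝟙 ⊗ q) ⊖ (⊝ 𝟙 ⊗ p) ⊗ s ≡ p ⊗ s ⊖ r ⊗ q
  identity = solve-∀ ℤσ-ring

det2≡𝟙⇒Irreducibleˡ : ∀ x y → det2 x y ≡ 𝟙 → Irreducible x
det2≡𝟙⇒Irreducibleˡ x y det≡𝟙 = not-both-zero x y det≡𝟙 , common-factor-unit x y det≡𝟙
  where
  not-both-zero : ∀ x y → det2 x y ≡ 𝟙 → NotBothZero x
  not-both-zero (p , q) (r , s) det≡𝟙 (refl , refl) = 𝟘≢𝟙 (trans (sym (vanish r s)) det≡𝟙)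
    where
    vanish : ∀ r s → 𝟘 ⊗ s ⊖ r ⊗ 𝟘 ≡ 𝟘
    vanish = solve-∀ ℤσ-ring
  common-factor-unit : ∀ x y → det2 x y ≡ 𝟙 → ∀ k → k ∣σ proj₁ x → k ∣σ proj₂ x → HasAbs1 k
  common-factor-unit (p , q) (r , s) det≡𝟙 k (t , refl) (t′ , refl) =
    x⊗y≡𝟙⇒HasAbs1 k (t ⊗ s ⊖ r ⊗ t′) (trans (factor k t t′ r s) det≡𝟙)
    where
    factor : ∀ k t t′ r s → k ⊗ (t ⊗ s ⊖ r ⊗ t′) ≡ (k ⊗ t) ⊗ s ⊖ r ⊗ (k ⊗ t′)
    factor = solve-∀ ℤσ-ring

det2≡𝟙⇒Irreducibleʳ : ∀ x y → det2 x y ≡ 𝟙 → Irreducible y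
det2≡𝟙⇒Irreducibleʳ x y det≡𝟙 = det2≡𝟙⇒Irreducibleˡ y (⊝ 𝟙 *ₗ x) (trans (det2-swap x y) det≡𝟙)

-- Cramer's rule for z in the basis a, b, whose b-coordinate vanishes.
SamePoint⇒multipleˡ : ∀ a b z → det2 a b ≡ 𝟙 → SamePoint z a → z ≡ det2 z b *ₗ a
SamePoint⇒multipleˡ (p , q) (r , s) (u , v) det≡𝟙 z∼a = cong₂ _,_
  (begin
    u                                            ≡⟨ solve (u ∷ r ∷ []) ℤσ-ring ⟩
    u ⊗ 𝟙 ⊕ r ⊗ 𝟘                                ≡⟨ cong₂ (λ d e → u ⊗ d ⊕ r ⊗ e) (sym det≡𝟙) (sym det-za≡𝟘) ⟩
    u ⊗ (p ⊗ s ⊖ r ⊗ q) ⊕ r ⊗ (u ⊗ q ⊖ p ⊗ v)    ≡⟨ solve (p ∷ q ∷ r ∷ s ∷ u ∷ v ∷ []) ℤσ-ring ⟩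
    (u ⊗ s ⊖ r ⊗ v) ⊗ p                          ∎)
  (begin
    v                                            ≡⟨ solve (v ∷ s ∷ []) ℤσ-ring ⟩
    v ⊗ 𝟙 ⊕ s ⊗ 𝟘                                ≡⟨ cong₂ (λ d e → v ⊗ d ⊕ s ⊗ e) (sym det≡𝟙) (sym det-za≡𝟘) ⟩
    v ⊗ (p ⊗ s ⊖ r ⊗ q) ⊕ s ⊗ (u ⊗ q ⊖ p ⊗ v)    ≡⟨ solve (p ∷ q ∷ r ∷ s ∷ u ∷ v ∷ []) ℤσ-ring ⟩
    (u ⊗ s ⊖ r ⊗ v) ⊗ q                          ∎)
  where
  det-za≡𝟘 : u ⊗ q ⊖ p ⊗ v ≡ 𝟘
  det-za≡𝟘 = SamePoint⇒det2≡𝟘 (u , v) (p , q) z∼a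

SamePoint⇒multipleʳ : ∀ a b z → det2 a b ≡ 𝟙 → SamePoint z b → z ≡ det2 a z *ₗ b
SamePoint⇒multipleʳ (p , q) (r , s) (u , v) det≡𝟙 z∼b = cong₂ _,_
  (begin
    u                                            ≡⟨ solve (u ∷ p ∷ []) ℤσ-ring ⟩
    u ⊗ 𝟙 ⊕ p ⊗ 𝟘                                ≡⟨ cong₂ (λ d e → u ⊗ d ⊕ p ⊗ e) (sym det≡𝟙) (sym det-bz≡𝟘) ⟩
    u ⊗ (p ⊗ s ⊖ r ⊗ q) ⊕ p ⊗ (r ⊗ v ⊖ u ⊗ s)    ≡⟨ solve (p ∷ q ∷ r ∷ s ∷ u ∷ v ∷ []) ℤσ-ring ⟩
    (p ⊗ v ⊖ u ⊗ q) ⊗ r                          ∎)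
  (begin
    v                                            ≡⟨ solve (v ∷ q ∷ []) ℤσ-ring ⟩
    v ⊗ 𝟙 ⊕ q ⊗ 𝟘                                ≡⟨ cong₂ (λ d e → v ⊗ d ⊕ q ⊗ e) (sym det≡𝟙) (sym det-bz≡𝟘) ⟩
    v ⊗ (p ⊗ s ⊖ r ⊗ q) ⊕ q ⊗ (r ⊗ v ⊖ u ⊗ s)    ≡⟨ solve (p ∷ q ∷ r ∷ s ∷ u ∷ v ∷ []) ℤσ-ring ⟩
    (p ⊗ v ⊖ u ⊗ q) ⊗ s                          ∎)
  where
  det-bz≡𝟘 : r ⊗ v ⊖ u ⊗ s ≡ 𝟘
  det-bz≡𝟘 = SamePoint⇒det2≡𝟘 (r , s) (u , v) (SamePoint-sym (u , v) (r , s) z∼b)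

det2-act : ∀ A x y → det2 (act A x) (act A y) ≡ det2 x y
det2-act A (p , q) (r , s) = cancel-𝟙 (identity (a A) (b A) (c A) (d A) p q r s) (det A)
  where
  identity : ∀ a b c d p q r s →
    (a ⊗ p ⊕ b ⊗ q) ⊗ (c ⊗ r ⊕ d ⊗ s) ⊖ (a ⊗ r ⊕ b ⊗ s) ⊗ (c ⊗ p ⊕ d ⊗ q)
    ≡ (p ⊗ s ⊖ r ⊗ q) ⊗ (a ⊗ d ⊖ b ⊗ c)
  identity = solve-∀ ℤσ-ring

det2-actInvT : ∀ A x y → det2 (actInvT A x) (actInvT A y) ≡ det2 x y
det2-actInvT A (p , q) (r , s) = cancel-𝟙 (identity (a A) (b A) (c A) (d A) p q r s) (det A)
  where
  identity : ∀ a b c d p q r s →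
    (d ⊗ p ⊖ c ⊗ q) ⊗ (⊝ b ⊗ r ⊕ a ⊗ s) ⊖ (d ⊗ r ⊖ c ⊗ s) ⊗ (⊝ b ⊗ p ⊕ a ⊗ q)
    ≡ (p ⊗ s ⊖ r ⊗ q) ⊗ (a ⊗ d ⊖ b ⊗ c)
  identity = solve-∀ ℤσ-ring

act-·-actInvT : ∀ A x y → act A x · actInvT A y ≡ x · y
act-·-actInvT A (p , q) (r , s) = cancel-𝟙 (identity (a A) (b A) (c A) (d A) p q r s) (det A)
  where
  identity : ∀ a b c d p q r s →
    (a ⊗ p ⊕ b ⊗ q) ⊗ (d ⊗ r ⊖ c ⊗ s) ⊕ (c ⊗ p ⊕ d ⊗ q) ⊗ (⊝ b ⊗ r ⊕ a ⊗ s)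
    ≡ (p ⊗ r ⊕ q ⊗ s) ⊗ (a ⊗ d ⊖ b ⊗ c)
  identity = solve-∀ ℤσ-ring

-- If f x were zero then so would be det2 x y = det2 (f x) (f y) for all y, in particular for y = (𝟘 , 𝟙), (𝟙 , 𝟘).
det2-preserving⇒NotBothZero : (f : Pair → Pair) → (∀ x y → det2 (f x) (f y) ≡ det2 x y) →
                               ∀ x → NotBothZero x → NotBothZero (f x)
det2-preserving⇒NotBothZero f f-det2 (p , q) x≢𝟘 (fx₁≡𝟘 , fx₂≡𝟘) = x≢𝟘 (p≡𝟘 , q≡𝟘)
  where
  vanish : ∀ y → det2 (p , q) y ≡ 𝟘
  vanish y = begin
    det2 (p , q) y                                                   ≡⟨ sym (f-det2 (p , q) y) ⟩
    proj₁ (f (p , q)) ⊗ proj₂ (f y) ⊖ proj₁ (f y) ⊗ proj₂ (f (p , q))  ≡⟨ cong₂ (λ s t → s ⊗ proj₂ (f y) ⊖ proj₁ (f y) ⊗ t) fx₁≡𝟘 fx₂≡𝟘 ⟩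
    𝟘 ⊗ proj₂ (f y) ⊖ proj₁ (f y) ⊗ 𝟘                                ≡⟨ identity (proj₁ (f y)) (proj₂ (f y)) ⟩
    𝟘                                                                ∎
    where
    identity : ∀ u v → 𝟘 ⊗ v ⊖ u ⊗ 𝟘 ≡ 𝟘
    identity = solve-∀ ℤσ-ring
  p≡𝟘 : p ≡ 𝟘
  p≡𝟘 = begin
    p                                ≡⟨ solve (p ∷ q ∷ []) ℤσ-ring ⟩
    p ⊗ 𝟙 ⊖ 𝟘 ⊗ q                    ≡⟨ vanish (𝟘 , 𝟙) ⟩
    𝟘                                ∎
  q≡𝟘 : q ≡ 𝟘
  q≡𝟘 = begin
    q                                ≡⟨ solve (p ∷ q ∷ []) ℤσ-ring ⟩
    ⊝ (p ⊗ 𝟘 ⊖ 𝟙 ⊗ q)                ≡⟨ cong ⊝_ (vanish (𝟙 , 𝟘)) ⟩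
    ⊝ 𝟘                              ≡⟨⟩
    𝟘                                ∎

det2-preserving⇒SamePoint : (f : Pair → Pair) → (∀ x y → det2 (f x) (f y) ≡ det2 x y) →
                            ∀ x y → SamePoint x y → SamePoint (f x) (f y)
det2-preserving⇒SamePoint f f-det2 x y x∼y =
  det2≡𝟘⇒SamePoint (f x) (f y) (trans (f-det2 x y) (SamePoint⇒det2≡𝟘 x y x∼y))

·-comm : ∀ x y → x · y ≡ y · x
·-comm (p , q) (r , s) = identity p q r s
  where
  identity : ∀ p q r s → p ⊗ r ⊕ q ⊗ s ≡ r ⊗ p ⊕ s ⊗ q
  identity = solve-∀ ℤσ-ring

cramer : Pair → Pair → ℤσ → ℤσ → Pair
cramer (p₀ , q₀) (p₁ , q₁) α β = q₁ ⊗ α ⊖ q₀ ⊗ β , p₀ ⊗ β ⊖ p₁ ⊗ α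

cramer-·₀ : ∀ b₀ b₁ α β → det2 b₀ b₁ ≡ 𝟙 → b₀ · cramer b₀ b₁ α β ≡ α
cramer-·₀ (p₀ , q₀) (p₁ , q₁) α β = cancel-𝟙 (identity p₀ q₀ p₁ q₁ α β)
  where
  identity : ∀ p₀ q₀ p₁ q₁ α β →
    p₀ ⊗ (q₁ ⊗ α ⊖ q₀ ⊗ β) ⊕ q₀ ⊗ (p₀ ⊗ β ⊖ p₁ ⊗ α) ≡ α ⊗ (p₀ ⊗ q₁ ⊖ p₁ ⊗ q₀)
  identity = solve-∀ ℤσ-ring

cramer-·₁ : ∀ b₀ b₁ α β → det2 b₀ b₁ ≡ 𝟙 → b₁ · cramer b₀ b₁ α β ≡ β
cramer-·₁ (p₀ , q₀) (p₁ , q₁) α β = cancel-𝟙 (identity p₀ q₀ p₁ q₁ α β)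
  where
  identity : ∀ p₀ q₀ p₁ q₁ α β →
    p₁ ⊗ (q₁ ⊗ α ⊖ q₀ ⊗ β) ⊕ q₁ ⊗ (p₀ ⊗ β ⊖ p₁ ⊗ α) ≡ β ⊗ (p₀ ⊗ q₁ ⊖ p₁ ⊗ q₀)
  identity = solve-∀ ℤσ-ring

cramer-· : ∀ b₀ b₁ z → det2 b₀ b₁ ≡ 𝟙 → cramer b₀ b₁ (b₀ · z) (b₁ · z) ≡ z
cramer-· (p₀ , q₀) (p₁ , q₁) (u , v) det≡𝟙 = cong₂ _,_
  (cancel-𝟙 (identity₁ p₀ q₀ p₁ q₁ u v) det≡𝟙) (cancel-𝟙 (identity₂ p₀ q₀ p₁ q₁ u v) det≡𝟙)
  where
  identity₁ : ∀ p₀ q₀ p₁ q₁ u v →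
    q₁ ⊗ (p₀ ⊗ u ⊕ q₀ ⊗ v) ⊖ q₀ ⊗ (p₁ ⊗ u ⊕ q₁ ⊗ v) ≡ u ⊗ (p₀ ⊗ q₁ ⊖ p₁ ⊗ q₀)
  identity₁ = solve-∀ ℤσ-ring
  identity₂ : ∀ p₀ q₀ p₁ q₁ u v →
    p₀ ⊗ (p₁ ⊗ u ⊕ q₁ ⊗ v) ⊖ p₁ ⊗ (p₀ ⊗ u ⊕ q₀ ⊗ v) ≡ v ⊗ (p₀ ⊗ q₁ ⊖ p₁ ⊗ q₀)
  identity₂ = solve-∀ ℤσ-ring

·-determined : ∀ b₀ b₁ z w → det2 b₀ b₁ ≡ 𝟙 → b₀ · z ≡ b₀ · w → b₁ · z ≡ b₁ · w → z ≡ w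
·-determined b₀ b₁ z w det≡𝟙 e₀ e₁ = begin
  z                                ≡⟨ sym (cramer-· b₀ b₁ z det≡𝟙) ⟩
  cramer b₀ b₁ (b₀ · z) (b₁ · z)   ≡⟨ cong₂ (cramer b₀ b₁) e₀ e₁ ⟩
  cramer b₀ b₁ (b₀ · w) (b₁ · w)   ≡⟨ cramer-· b₀ b₁ w det≡𝟙 ⟩
  w                                ∎

-- A = Y X⁻¹, where X and Y have columns x₀, x₁ and y₀, y₁
SL₂-mapping : ∀ x₀ x₁ y₀ y₁ → det2 x₀ x₁ ≡ 𝟙 → det2 y₀ y₁ ≡ 𝟙 →
              Σ SL₂ λ A → act A x₀ ≡ y₀ × act A x₁ ≡ y₁
SL₂-mapping (p , q) (r , s) (p′ , q′) (r′ , s′) det-x≡𝟙 det-y≡𝟙 =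
  A ,
  cong₂ _,_ (cancel-𝟙 (image₀ p q r s p′ r′) det-x≡𝟙) (cancel-𝟙 (image₀ p q r s q′ s′) det-x≡𝟙) ,
  cong₂ _,_ (cancel-𝟙 (image₁ p q r s p′ r′) det-x≡𝟙) (cancel-𝟙 (image₁ p q r s q′ s′) det-x≡𝟙)
  where
  det-A : (p′ ⊗ s ⊖ r′ ⊗ q) ⊗ (s′ ⊗ p ⊖ q′ ⊗ r) ⊖ (r′ ⊗ p ⊖ p′ ⊗ r) ⊗ (q′ ⊗ s ⊖ s′ ⊗ q) ≡ 𝟙
  det-A = begin
    (p′ ⊗ s ⊖ r′ ⊗ q) ⊗ (s′ ⊗ p ⊖ q′ ⊗ r) ⊖ (r′ ⊗ p ⊖ p′ ⊗ r) ⊗ (q′ ⊗ s ⊖ s′ ⊗ q)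
      ≡⟨ solve (p ∷ q ∷ r ∷ s ∷ p′ ∷ q′ ∷ r′ ∷ s′ ∷ []) ℤσ-ring ⟩
    (p′ ⊗ s′ ⊖ r′ ⊗ q′) ⊗ (p ⊗ s ⊖ r ⊗ q)   ≡⟨ cong₂ _⊗_ det-y≡𝟙 det-x≡𝟙 ⟩
    𝟙 ⊗ 𝟙                                 ≡⟨⟩
    𝟙                                     ∎
  A : SL₂
  A = record { a = p′ ⊗ s ⊖ r′ ⊗ q ; b = r′ ⊗ p ⊖ p′ ⊗ r ; c = q′ ⊗ s ⊖ s′ ⊗ q ; d = s′ ⊗ p ⊖ q′ ⊗ r
             ; det = det-A }
  image₀ : ∀ p q r s t t′ → (t ⊗ s ⊖ t′ ⊗ q) ⊗ p ⊕ (t′ ⊗ p ⊖ t ⊗ r) ⊗ q ≡ t ⊗ (p ⊗ s ⊖ r ⊗ q)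
  image₀ = solve-∀ ℤσ-ring
  image₁ : ∀ p q r s t t′ → (t ⊗ s ⊖ t′ ⊗ q) ⊗ r ⊕ (t′ ⊗ p ⊖ t ⊗ r) ⊗ s ≡ t′ ⊗ (p ⊗ s ⊖ r ⊗ q)
  image₁ = solve-∀ ℤσ-ring

-- A maps x₀, x₁ to x′₀, x′₁; pairing with the bases x′₀, x′₁ and y′₀, y′₁ then pins down every A⁻ᵀ y j and A x i.
scalar-injective : (x y x′ y′ : ℤ → Pair) →
  det2 (x 0ℤ) (x 1ℤ) ≡ 𝟙 → det2 (x′ 0ℤ) (x′ 1ℤ) ≡ 𝟙 → det2 (y′ 0ℤ) (y′ 1ℤ) ≡ 𝟙 →
  (∀ i j → x i · y j ≡ x′ i · y′ j) →
  Σ SL₂ λ A → (∀ i → act A (x i) ≡ x′ i) × (∀ j → actInvT A (y j) ≡ y′ j)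
scalar-injective x y x′ y′ det-x≡𝟙 det-x′≡𝟙 det-y′≡𝟙 x·y≡x′·y′ = A , maps-x , maps-y
  where
  mapping : Σ SL₂ λ A → act A (x 0ℤ) ≡ x′ 0ℤ × act A (x 1ℤ) ≡ x′ 1ℤ
  mapping = SL₂-mapping (x 0ℤ) (x 1ℤ) (x′ 0ℤ) (x′ 1ℤ) det-x≡𝟙 det-x′≡𝟙
  A : SL₂
  A = proj₁ mapping
  pairing : ∀ i j → act A (x i) · actInvT A (y j) ≡ x′ i · y′ j
  pairing i j = trans (act-·-actInvT A (x i) (y j)) (x·y≡x′·y′ i j)
  maps-y : ∀ j → actInvT A (y j) ≡ y′ j
  maps-y j = ·-determined (x′ 0ℤ) (x′ 1ℤ) (actInvT A (y j)) (y′ j) det-x′≡𝟙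
    (subst (λ x₀ → x₀ · actInvT A (y j) ≡ x′ 0ℤ · y′ j) (proj₁ (proj₂ mapping)) (pairing 0ℤ j))
    (subst (λ x₁ → x₁ · actInvT A (y j) ≡ x′ 1ℤ · y′ j) (proj₂ (proj₂ mapping)) (pairing 1ℤ j))
  maps-x : ∀ i → act A (x i) ≡ x′ i
  maps-x i = ·-determined (y′ 0ℤ) (y′ 1ℤ) (act A (x i)) (x′ i) det-y′≡𝟙 (paired 0ℤ) (paired 1ℤ)
    where
    paired : ∀ j → y′ j · act A (x i) ≡ y′ j · x′ i
    paired j = begin
      y′ j · act A (x i)              ≡⟨ ·-comm (y′ j) (act A (x i)) ⟩
      act A (x i) · y′ j              ≡⟨ cong (act A (x i) ·_) (sym (maps-y j)) ⟩
      act A (x i) · actInvT A (y j)   ≡⟨ pairing i j ⟩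
      x′ i · y′ j                     ≡⟨ ·-comm (x′ i) (y′ j) ⟩
      y′ j · x′ i                     ∎

infixl 6 _-ᵥ_

_-ᵥ_ : Pair → Pair → Pair
(p , q) -ᵥ (r , s) = p ⊖ r , q ⊖ s

·-*ₗ-ᵥ : ∀ c x y w → (c *ₗ x -ᵥ y) · w ≡ c ⊗ (x · w) ⊖ y · w
·-*ₗ-ᵥ c (p , q) (r , s) (u , v) = identity c p q r s u v
  where
  identity : ∀ c p q r s u v → (c ⊗ p ⊖ r) ⊗ u ⊕ (c ⊗ q ⊖ s) ⊗ v ≡ c ⊗ (p ⊗ u ⊕ q ⊗ v) ⊖ (r ⊗ u ⊕ s ⊗ v)
  identity = solve-∀ ℤσ-ring

·-e₁ : ∀ x → x · (𝟙 , 𝟘) ≡ proj₁ x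
·-e₁ (p , q) = identity p q
  where
  identity : ∀ p q → p ⊗ 𝟙 ⊕ q ⊗ 𝟘 ≡ p
  identity = solve-∀ ℤσ-ring

·-e₂ : ∀ x → x · (𝟘 , 𝟙) ≡ proj₂ x
·-e₂ (p , q) = identity p q
  where
  identity : ∀ p q → p ⊗ 𝟘 ⊕ q ⊗ 𝟙 ≡ q
  identity = solve-∀ ℤσ-ring

-- From det2 x₁ x₂ · x₀ - det2 x₀ x₂ · x₁ + det2 x₀ x₁ · x₂ = 0, which holds for any three vectors of ℤ[σ]².
unimodular-recurrence : ∀ x₀ x₁ x₂ → det2 x₀ x₁ ≡ 𝟙 → det2 x₁ x₂ ≡ 𝟙 → x₂ ≡ det2 x₀ x₂ *ₗ x₁ -ᵥ x₀
unimodular-recurrence (p₀ , q₀) (p₁ , q₁) (p₂ , q₂) det₀₁≡𝟙 det₁₂≡𝟙 = cong₂ _,_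
  (begin
    p₂                                                         ≡⟨ solve (p₀ ∷ p₂ ∷ []) ℤσ-ring ⟩
    p₂ ⊗ 𝟙 ⊕ p₀ ⊗ 𝟙 ⊖ p₀                                       ≡⟨ cong₂ (λ s t → p₂ ⊗ s ⊕ p₀ ⊗ t ⊖ p₀)
                                                                    (sym det₀₁≡𝟙) (sym det₁₂≡𝟙) ⟩
    p₂ ⊗ (p₀ ⊗ q₁ ⊖ p₁ ⊗ q₀) ⊕ p₀ ⊗ (p₁ ⊗ q₂ ⊖ p₂ ⊗ q₁) ⊖ p₀   ≡⟨ solve (p₀ ∷ q₀ ∷ p₁ ∷ q₁ ∷ p₂ ∷ q₂ ∷ []) ℤσ-ring ⟩
    (p₀ ⊗ q₂ ⊖ p₂ ⊗ q₀) ⊗ p₁ ⊖ p₀                               ∎)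
  (begin
    q₂                                                         ≡⟨ solve (q₀ ∷ q₂ ∷ []) ℤσ-ring ⟩
    q₂ ⊗ 𝟙 ⊕ q₀ ⊗ 𝟙 ⊖ q₀                                       ≡⟨ cong₂ (λ s t → q₂ ⊗ s ⊕ q₀ ⊗ t ⊖ q₀)
                                                                    (sym det₀₁≡𝟙) (sym det₁₂≡𝟙) ⟩
    q₂ ⊗ (p₀ ⊗ q₁ ⊖ p₁ ⊗ q₀) ⊕ q₀ ⊗ (p₁ ⊗ q₂ ⊖ p₂ ⊗ q₁) ⊖ q₀   ≡⟨ solve (p₀ ∷ q₀ ∷ p₁ ∷ q₁ ∷ p₂ ∷ q₂ ∷ []) ℤσ-ring ⟩
    (p₀ ⊗ q₂ ⊖ p₂ ⊗ q₀) ⊗ q₁ ⊖ q₀                               ∎)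

-- Tame SL₂-tilings

recurrence-sym : ∀ a b c β → c ≡ β ⊗ b ⊖ a → a ≡ β ⊗ b ⊖ c
recurrence-sym a b _ β refl = identity a b β
  where
  identity : ∀ a b β → a ≡ β ⊗ b ⊖ (β ⊗ b ⊖ a)
  identity = solve-∀ ℤσ-ring

det3-recurrent : ∀ β a₀ a₁ a₂ b₀ b₁ b₂ →
  det3 (a₀ , a₁ , a₂) (b₀ , b₁ , b₂) (β ⊗ b₀ ⊖ a₀ , β ⊗ b₁ ⊖ a₁ , β ⊗ b₂ ⊖ a₂) ≡ 𝟘
det3-recurrent = expansion
  where
  expansion : ∀ β a₀ a₁ a₂ b₀ b₁ b₂ →
    a₀ ⊗ (b₁ ⊗ (β ⊗ b₂ ⊖ a₂) ⊖ b₂ ⊗ (β ⊗ b₁ ⊖ a₁)) ⊖ a₁ ⊗ (b₀ ⊗ (β ⊗ b₂ ⊖ a₂) ⊖ b₂ ⊗ (β ⊗ b₀ ⊖ a₀))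
      ⊕ a₂ ⊗ (b₀ ⊗ (β ⊗ b₁ ⊖ a₁) ⊖ b₁ ⊗ (β ⊗ b₀ ⊖ a₀)) ≡ 𝟘
  expansion = solve-∀ ℤσ-ring

det3-recurrent-but-last : ∀ β a₀ a₁ a₂ b₀ b₁ b₂ c₂ →
  det3 (a₀ , a₁ , a₂) (b₀ , b₁ , b₂) (β ⊗ b₀ ⊖ a₀ , β ⊗ b₁ ⊖ a₁ , c₂)
    ≡ (c₂ ⊖ (β ⊗ b₂ ⊖ a₂)) ⊗ (a₀ ⊗ b₁ ⊖ a₁ ⊗ b₀)
det3-recurrent-but-last = expansion
  where
  expansion : ∀ β a₀ a₁ a₂ b₀ b₁ b₂ c₂ →
    a₀ ⊗ (b₁ ⊗ c₂ ⊖ b₂ ⊗ (β ⊗ b₁ ⊖ a₁)) ⊖ a₁ ⊗ (b₀ ⊗ c₂ ⊖ b₂ ⊗ (β ⊗ b₀ ⊖ a₀))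
      ⊕ a₂ ⊗ (b₀ ⊗ (β ⊗ b₁ ⊖ a₁) ⊖ b₁ ⊗ (β ⊗ b₀ ⊖ a₀))
    ≡ (c₂ ⊖ (β ⊗ b₂ ⊖ a₂)) ⊗ (a₀ ⊗ b₁ ⊖ a₁ ⊗ b₀)
  expansion = solve-∀ ℤσ-ring

det3-recurrent-but-first : ∀ β a₀ a₁ a₂ b₀ b₁ b₂ c₀ →
  det3 (a₀ , a₁ , a₂) (b₀ , b₁ , b₂) (c₀ , β ⊗ b₁ ⊖ a₁ , β ⊗ b₂ ⊖ a₂)
    ≡ (c₀ ⊖ (β ⊗ b₀ ⊖ a₀)) ⊗ (a₁ ⊗ b₂ ⊖ a₂ ⊗ b₁)
det3-recurrent-but-first = expansion
  where
  expansion : ∀ β a₀ a₁ a₂ b₀ b₁ b₂ c₀ →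
    a₀ ⊗ (b₁ ⊗ (β ⊗ b₂ ⊖ a₂) ⊖ b₂ ⊗ (β ⊗ b₁ ⊖ a₁)) ⊖ a₁ ⊗ (b₀ ⊗ (β ⊗ b₂ ⊖ a₂) ⊖ b₂ ⊗ c₀)
      ⊕ a₂ ⊗ (b₀ ⊗ (β ⊗ b₁ ⊖ a₁) ⊖ b₁ ⊗ c₀)
    ≡ (c₀ ⊖ (β ⊗ b₀ ⊖ a₀)) ⊗ (a₁ ⊗ b₂ ⊖ a₂ ⊗ b₁)
  expansion = solve-∀ ℤσ-ring

scalarTiling : (ℤ → Pair) → (ℤ → Pair) → Matrix
scalarTiling x y i j = x i · y j

scalarTiling-isTameSL₂Tiling : ∀ x y → Unimodular x → Unimodular y → IsTameSL₂Tiling (scalarTiling x y)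
scalarTiling-isTameSL₂Tiling x y x-unimodular y-unimodular = tiling , tame
  where
  tiling : IsSL₂Tiling (scalarTiling x y)
  tiling i j = trans (det2-cauchyBinet (x i) (x (i ℤ.+ 1ℤ)) (y j) (y (j ℤ.+ 1ℤ)))
                     (cong₂ _⊗_ (x-unimodular i) (y-unimodular j))
  tame : IsTame (scalarTiling x y)
  tame i j = begin
    det3 (row3 (scalarTiling x y) i j) (row3 (scalarTiling x y) i₁ j) (row3 (scalarTiling x y) i₂ j)
      ≡⟨ cong (det3 (row3 (scalarTiling x y) i j) (row3 (scalarTiling x y) i₁ j))
              (cong₂ _,_ (third-row j) (cong₂ _,_ (third-row j₁) (third-row j₂))) ⟩
    det3 (x i · y j , x i · y j₁ , x i · y j₂) (x i₁ · y j , x i₁ · y j₁ , x i₁ · y j₂)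
         (β ⊗ (x i₁ · y j) ⊖ x i · y j , β ⊗ (x i₁ · y j₁) ⊖ x i · y j₁ , β ⊗ (x i₁ · y j₂) ⊖ x i · y j₂)
      ≡⟨ det3-recurrent β (x i · y j) (x i · y j₁) (x i · y j₂) (x i₁ · y j) (x i₁ · y j₁) (x i₁ · y j₂) ⟩
    𝟘 ∎
    where
    i₁ i₂ j₁ j₂ : ℤ
    i₁ = i ℤ.+ 1ℤ
    i₂ = i₁ ℤ.+ 1ℤ
    j₁ = j ℤ.+ 1ℤ
    j₂ = j₁ ℤ.+ 1ℤ
    β : ℤσ
    β = det2 (x i) (x i₂)
    third-row : ∀ k → x i₂ · y k ≡ β ⊗ (x i₁ · y k) ⊖ x i · y k
    third-row k = trans (cong (_· y k) (unimodular-recurrence (x i) (x i₁) (x i₂) (x-unimodular i) (x-unimodular i₁)))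
                        (·-*ₗ-ᵥ β (x i₁) (x i) (y k))

columns₀₁ : Matrix → ℤ → Pair
columns₀₁ m i = m i 0ℤ , m i 1ℤ

columns₀₁-unimodular : ∀ m → IsSL₂Tiling m → Unimodular (columns₀₁ m)
columns₀₁-unimodular m tiling i =
  trans (cong (m i 0ℤ ⊗ m (i ℤ.+ 1ℤ) 1ℤ ⊖_) (⊗-comm (m (i ℤ.+ 1ℤ) 0ℤ) (m i 1ℤ))) (tiling i 0ℤ)

rowCoefficient : Matrix → ℤ → ℤσ
rowCoefficient m i = det2 (columns₀₁ m i) (columns₀₁ m (i ℤ.+ 1ℤ ℤ.+ 1ℤ))

-- The recurrence holds in columns 0 and 1 by unimodular-recurrence, and spreads to all columns because every
-- 3 × 3 minor vanishes while the 2 × 2 minors are 𝟙.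
row-recurrence : ∀ m → IsTameSL₂Tiling m → ∀ i j →
  m (i ℤ.+ 1ℤ ℤ.+ 1ℤ) j ≡ rowCoefficient m i ⊗ m (i ℤ.+ 1ℤ) j ⊖ m i j
row-recurrence m (tiling , tame) i = ℤ-induction₂ (cong proj₁ first-columns) (cong proj₂ first-columns) suc-step pred-step
  where
  i₁ i₂ : ℤ
  i₁ = i ℤ.+ 1ℤ
  i₂ = i₁ ℤ.+ 1ℤ
  β : ℤσ
  β = rowCoefficient m i
  Recurrent : ℤ → Set
  Recurrent j = m i₂ j ≡ β ⊗ m i₁ j ⊖ m i j
  first-columns : columns₀₁ m i₂ ≡ β *ₗ columns₀₁ m i₁ -ᵥ columns₀₁ m i
  first-columns = unimodular-recurrence (columns₀₁ m i) (columns₀₁ m i₁) (columns₀₁ m i₂)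
                    (columns₀₁-unimodular m tiling i) (columns₀₁-unimodular m tiling i₁)
  suc-step : ∀ j → Recurrent j → Recurrent (j ℤ.+ 1ℤ) → Recurrent (j ℤ.+ 1ℤ ℤ.+ 1ℤ)
  suc-step j r₀ r₁ = x⊖y≡𝟘⇒x≡y (m i₂ j₂) (β ⊗ m i₁ j₂ ⊖ m i j₂) (begin
    ρ                                                                       ≡⟨ sym (⊗-identityʳ ρ) ⟩
    ρ ⊗ 𝟙                                                                   ≡⟨ cong (ρ ⊗_) (sym (tiling i j)) ⟩
    ρ ⊗ (m i j ⊗ m i₁ j₁ ⊖ m i j₁ ⊗ m i₁ j)
      ≡⟨ sym (det3-recurrent-but-last β (m i j) (m i j₁) (m i j₂) (m i₁ j) (m i₁ j₁) (m i₁ j₂) (m i₂ j₂)) ⟩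
    det3 (row3 m i j) (row3 m i₁ j) (β ⊗ m i₁ j ⊖ m i j , β ⊗ m i₁ j₁ ⊖ m i j₁ , m i₂ j₂)
      ≡⟨ cong₂ (λ s t → det3 (row3 m i j) (row3 m i₁ j) (s , t , m i₂ j₂)) (sym r₀) (sym r₁) ⟩
    det3 (row3 m i j) (row3 m i₁ j) (row3 m i₂ j)                          ≡⟨ tame i j ⟩
    𝟘                                                                       ∎)
    where
    j₁ j₂ : ℤ
    j₁ = j ℤ.+ 1ℤ
    j₂ = j₁ ℤ.+ 1ℤ
    ρ : ℤσ
    ρ = m i₂ j₂ ⊖ (β ⊗ m i₁ j₂ ⊖ m i j₂)
  pred-step : ∀ j → Recurrent (j ℤ.+ 1ℤ) → Recurrent (j ℤ.+ 1ℤ ℤ.+ 1ℤ) → Recurrent j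
  pred-step j r₁ r₂ = x⊖y≡𝟘⇒x≡y (m i₂ j) (β ⊗ m i₁ j ⊖ m i j) (begin
    ρ                                                                       ≡⟨ sym (⊗-identityʳ ρ) ⟩
    ρ ⊗ 𝟙                                                                   ≡⟨ cong (ρ ⊗_) (sym (tiling i j₁)) ⟩
    ρ ⊗ (m i j₁ ⊗ m i₁ j₂ ⊖ m i j₂ ⊗ m i₁ j₁)
      ≡⟨ sym (det3-recurrent-but-first β (m i j) (m i j₁) (m i j₂) (m i₁ j) (m i₁ j₁) (m i₁ j₂) (m i₂ j)) ⟩
    det3 (row3 m i j) (row3 m i₁ j) (m i₂ j , β ⊗ m i₁ j₁ ⊖ m i j₁ , β ⊗ m i₁ j₂ ⊖ m i j₂)
      ≡⟨ cong₂ (λ s t → det3 (row3 m i j) (row3 m i₁ j) (m i₂ j , s , t)) (sym r₁) (sym r₂) ⟩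
    det3 (row3 m i j) (row3 m i₁ j) (row3 m i₂ j)                          ≡⟨ tame i j ⟩
    𝟘                                                                       ∎)
    where
    j₁ j₂ : ℤ
    j₁ = j ℤ.+ 1ℤ
    j₂ = j₁ ℤ.+ 1ℤ
    ρ : ℤσ
    ρ = m i₂ j ⊖ (β ⊗ m i₁ j ⊖ m i j)

tame-rigidity : ∀ m m′ → IsTameSL₂Tiling m → IsTameSL₂Tiling m′ →
                (∀ i → columns₀₁ m i ≡ columns₀₁ m′ i) →
                (∀ j → m 0ℤ j ≡ m′ 0ℤ j) → (∀ j → m 1ℤ j ≡ m′ 1ℤ j) → ∀ i j → m i j ≡ m′ i j
tame-rigidity m m′ m-tame m′-tame same-columns same-row₀ same-row₁ =
  ℤ-induction₂ {λ i → ∀ j → m i j ≡ m′ i j} same-row₀ same-row₁ suc-step pred-step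
  where
  same-β : ∀ i → rowCoefficient m i ≡ rowCoefficient m′ i
  same-β i = cong₂ det2 (same-columns i) (same-columns (i ℤ.+ 1ℤ ℤ.+ 1ℤ))
  suc-step : ∀ i → (∀ j → m i j ≡ m′ i j) → (∀ j → m (i ℤ.+ 1ℤ) j ≡ m′ (i ℤ.+ 1ℤ) j) →
             ∀ j → m (i ℤ.+ 1ℤ ℤ.+ 1ℤ) j ≡ m′ (i ℤ.+ 1ℤ ℤ.+ 1ℤ) j
  suc-step i same₀ same₁ j = trans (row-recurrence m m-tame i j)
    (trans (cong₂ _⊖_ (cong₂ _⊗_ (same-β i) (same₁ j)) (same₀ j)) (sym (row-recurrence m′ m′-tame i j)))
  pred-step : ∀ i → (∀ j → m (i ℤ.+ 1ℤ) j ≡ m′ (i ℤ.+ 1ℤ) j) → (∀ j → m (i ℤ.+ 1ℤ ℤ.+ 1ℤ) j ≡ m′ (i ℤ.+ 1ℤ ℤ.+ 1ℤ) j) →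
              ∀ j → m i j ≡ m′ i j
  pred-step i same₁ same₂ j = trans (backward-recurrence m m-tame i j)
    (trans (cong₂ _⊖_ (cong₂ _⊗_ (same-β i) (same₁ j)) (same₂ j)) (sym (backward-recurrence m′ m′-tame i j)))
    where
    backward-recurrence : ∀ m → IsTameSL₂Tiling m → ∀ i j →
      m i j ≡ rowCoefficient m i ⊗ m (i ℤ.+ 1ℤ) j ⊖ m (i ℤ.+ 1ℤ ℤ.+ 1ℤ) j
    backward-recurrence m m-tame i j = recurrence-sym (m i j) (m (i ℤ.+ 1ℤ) j) (m (i ℤ.+ 1ℤ ℤ.+ 1ℤ) j)
      (rowCoefficient m i) (row-recurrence m m-tame i j)

tame-decomposition : ∀ m → IsTameSL₂Tiling m →
  Σ (ℤ → Pair) λ x → Σ (ℤ → Pair) λ y → Unimodular x × Unimodular y × ∀ i j → x i · y j ≡ m i j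
tame-decomposition m m-tame@(tiling , _) = x , y , x-unimodular , y-unimodular , tame-rigidity (scalarTiling x y) m
  (scalarTiling-isTameSL₂Tiling x y x-unimodular y-unimodular) m-tame same-columns row₀ row₁
  where
  x : ℤ → Pair
  x = columns₀₁ m
  x-unimodular : Unimodular x
  x-unimodular = columns₀₁-unimodular m tiling
  y : ℤ → Pair
  y j = cramer (x 0ℤ) (x 1ℤ) (m 0ℤ j) (m 1ℤ j)
  row₀ : ∀ j → x 0ℤ · y j ≡ m 0ℤ j
  row₀ j = cramer-·₀ (x 0ℤ) (x 1ℤ) (m 0ℤ j) (m 1ℤ j) (x-unimodular 0ℤ)
  row₁ : ∀ j → x 1ℤ · y j ≡ m 1ℤ j
  row₁ j = cramer-·₁ (x 0ℤ) (x 1ℤ) (m 0ℤ j) (m 1ℤ j) (x-unimodular 0ℤ)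
  y-unimodular : Unimodular y
  y-unimodular j = begin
    det2 (y j) (y j₁)                                         ≡⟨ sym (⊗-identityˡ (det2 (y j) (y j₁))) ⟩
    𝟙 ⊗ det2 (y j) (y j₁)                                     ≡⟨ cong (_⊗ det2 (y j) (y j₁)) (sym (x-unimodular 0ℤ)) ⟩
    det2 (x 0ℤ) (x 1ℤ) ⊗ det2 (y j) (y j₁)                    ≡⟨ sym (det2-cauchyBinet (x 0ℤ) (x 1ℤ) (y j) (y j₁)) ⟩
    (x 0ℤ · y j) ⊗ (x 1ℤ · y j₁) ⊖ (x 0ℤ · y j₁) ⊗ (x 1ℤ · y j)
      ≡⟨ cong₂ _⊖_ (cong₂ _⊗_ (row₀ j) (row₁ j₁)) (cong₂ _⊗_ (row₀ j₁) (row₁ j)) ⟩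
    m 0ℤ j ⊗ m 1ℤ j₁ ⊖ m 0ℤ j₁ ⊗ m 1ℤ j                       ≡⟨ tiling 0ℤ j ⟩
    𝟙                                                         ∎
    where
    j₁ : ℤ
    j₁ = j ℤ.+ 1ℤ
  y₀ : y 0ℤ ≡ (𝟙 , 𝟘)
  y₀ = ·-determined (x 0ℤ) (x 1ℤ) (y 0ℤ) (𝟙 , 𝟘) (x-unimodular 0ℤ)
         (trans (row₀ 0ℤ) (sym (·-e₁ (x 0ℤ)))) (trans (row₁ 0ℤ) (sym (·-e₁ (x 1ℤ))))
  y₁ : y 1ℤ ≡ (𝟘 , 𝟙)
  y₁ = ·-determined (x 0ℤ) (x 1ℤ) (y 1ℤ) (𝟘 , 𝟙) (x-unimodular 0ℤ)
         (trans (row₀ 1ℤ) (sym (·-e₂ (x 0ℤ)))) (trans (row₁ 1ℤ) (sym (·-e₂ (x 1ℤ))))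
  same-columns : ∀ i → columns₀₁ (scalarTiling x y) i ≡ columns₀₁ m i
  same-columns i = cong₂ _,_ (trans (cong (x i ·_) y₀) (·-e₁ (x i))) (trans (cong (x i ·_) y₁) (·-e₂ (x i)))

-- Normalised paths

vec : ∀ {u} → Normalisation u → ℤ → Pair
vec n i = num n i , den n i

alternating-units : (u : ℤ → ℤσ) → (∀ i → u i ⊗ u (i ℤ.+ 1ℤ) ≡ 𝟙) → ∃ λ k → ∀ i → u i ≡ σ^ (alt i k)
alternating-units u inv = from-u₀ (HasAbs1⇒σ^ℕ (u 0ℤ) (x⊗y≡𝟙⇒HasAbs1 (u 0ℤ) (u 1ℤ) (inv 0ℤ)))
  where
  module _ (k : ℤ) where
    suc-step : ∀ i → u i ≡ σ^ (alt i k) → u (i ℤ.+ 1ℤ) ≡ σ^ (alt (i ℤ.+ 1ℤ) k)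
    suc-step i uᵢ≡ = inverse-unique (u i) (u (i ℤ.+ 1ℤ)) (σ^ (alt (i ℤ.+ 1ℤ) k)) (inv i)
      (trans (cong (_⊗ σ^ (alt (i ℤ.+ 1ℤ) k)) uᵢ≡) (σ^alt-inverse i k))
    pred-step : ∀ i → u (i ℤ.+ 1ℤ) ≡ σ^ (alt (i ℤ.+ 1ℤ) k) → u i ≡ σ^ (alt i k)
    pred-step i uᵢ₊₁≡ = inverse-unique (u (i ℤ.+ 1ℤ)) (u i) (σ^ (alt i k))
      (trans (⊗-comm (u (i ℤ.+ 1ℤ)) (u i)) (inv i))
      (trans (⊗-comm (u (i ℤ.+ 1ℤ)) (σ^ (alt i k))) (trans (cong (σ^ (alt i k) ⊗_) uᵢ₊₁≡) (σ^alt-inverse i k)))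
  from-u₀ : (∃ λ k → u 0ℤ ≡ σ^ℕ k) → ∃ λ k → ∀ i → u i ≡ σ^ (alt i k)
  from-u₀ (k , u₀≡σᵏ) = + k , ℤ-induction u₀≡σᵏ (suc-step (+ k)) (pred-step (+ k))

-- Each x′ i is a multiple of x i, and comparing determinants shows that consecutive factors are mutually inverse.
unimodular-unique : (x x′ : ℤ → Pair) → Unimodular x → Unimodular x′ → (∀ i → SamePoint (x′ i) (x i)) →
                    ∃ λ k → ∀ i → x′ i ≡ σ^ (alt i k) *ₗ x i
unimodular-unique x x′ x-unimodular x′-unimodular x′∼x =
  proj₁ units , λ i → trans (multiple i) (cong (_*ₗ x i) (proj₂ units i))
  where
  scale : ℤ → ℤσ
  scale i = det2 (x′ i) (x (i ℤ.+ 1ℤ))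
  multiple : ∀ i → x′ i ≡ scale i *ₗ x i
  multiple i = SamePoint⇒multipleˡ (x i) (x (i ℤ.+ 1ℤ)) (x′ i) (x-unimodular i) (x′∼x i)
  inverse : ∀ i → scale i ⊗ scale (i ℤ.+ 1ℤ) ≡ 𝟙
  inverse i = begin
    scale i ⊗ scale i₁                                ≡⟨ sym (⊗-identityʳ (scale i ⊗ scale i₁)) ⟩
    (scale i ⊗ scale i₁) ⊗ 𝟙                          ≡⟨ cong ((scale i ⊗ scale i₁) ⊗_) (sym (x-unimodular i)) ⟩
    (scale i ⊗ scale i₁) ⊗ det2 (x i) (x i₁)          ≡⟨ sym (det2-*ₗ (scale i) (scale i₁) (x i) (x i₁)) ⟩
    det2 (scale i *ₗ x i) (scale i₁ *ₗ x i₁)          ≡⟨ cong₂ det2 (sym (multiple i)) (sym (multiple i₁)) ⟩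
    det2 (x′ i) (x′ i₁)                               ≡⟨ x′-unimodular i ⟩
    𝟙                                                 ∎
    where
    i₁ : ℤ
    i₁ = i ℤ.+ 1ℤ
  units : ∃ λ k → ∀ i → scale i ≡ σ^ (alt i k)
  units = alternating-units scale inverse

Normalisation-unique : ∀ {u} (n n′ : Normalisation u) → ∃ λ k → ∀ i → vec n′ i ≡ σ^ (alt i k) *ₗ vec n i
Normalisation-unique {u} n n′ = unimodular-unique (vec n) (vec n′) (unimod n) (unimod n′) λ i →
  SamePoint-trans (vec n′ i) (frac (u i)) (vec n i) (nonzero (u i))
    (proj₂ (repr n′ i)) (SamePoint-sym (vec n i) (frac (u i)) (proj₂ (repr n i)))

rescale : ∀ {u} → ℤ → Normalisation u → Normalisation u
rescale {u} k n = record
  { num = λ i → σ^ (alt i k) ⊗ num n i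
  ; den = λ i → σ^ (alt i k) ⊗ den n i
  ; repr = λ i → det2≡𝟙⇒Irreducibleˡ (σ^ (alt i k) *ₗ vec n i) (σ^ (alt (i ℤ.+ 1ℤ) k) *ₗ vec n (i ℤ.+ 1ℤ))
                   (unimodular i) ,
                 SamePoint-*ₗ (σ^ (alt i k)) (vec n i) (frac (u i)) (proj₂ (repr n i))
  ; unimod = unimodular
  }
  where
  unimodular : Unimodular (λ i → σ^ (alt i k) *ₗ vec n i)
  unimodular i = begin
    det2 (σ^ (alt i k) *ₗ vec n i) (σ^ (alt i₁ k) *ₗ vec n i₁)   ≡⟨ det2-*ₗ (σ^ (alt i k)) (σ^ (alt i₁ k)) (vec n i) (vec n i₁) ⟩
    (σ^ (alt i k) ⊗ σ^ (alt i₁ k)) ⊗ det2 (vec n i) (vec n i₁)   ≡⟨ cong₂ _⊗_ (σ^alt-inverse i k) (unimod n i) ⟩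
    𝟙 ⊗ 𝟙                                                        ≡⟨⟩
    𝟙                                                            ∎
    where
    i₁ : ℤ
    i₁ = i ℤ.+ 1ℤ

Normalisation-map : ∀ {u u′} (f : Pair → Pair) → (∀ x y → det2 (f x) (f y) ≡ det2 x y) →
                    (∀ i → SamePoint (f (frac (u i))) (frac (u′ i))) → Normalisation u → Normalisation u′
Normalisation-map {u} {u′} f f-det2 f[u]∼u′ n = record
  { num = λ i → proj₁ (f (vec n i))
  ; den = λ i → proj₂ (f (vec n i))
  ; repr = λ i → det2≡𝟙⇒Irreducibleˡ (f (vec n i)) (f (vec n (i ℤ.+ 1ℤ))) (unimodular i) ,
                 SamePoint-trans (f (vec n i)) (f (frac (u i))) (frac (u′ i))
                   (det2-preserving⇒NotBothZero f f-det2 (frac (u i)) (nonzero (u i)))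
                   (det2-preserving⇒SamePoint f f-det2 (vec n i) (frac (u i)) (proj₂ (repr n i)))
                   (f[u]∼u′ i)
  ; unimod = unimodular
  }
  where
  unimodular : Unimodular (λ i → f (vec n i))
  unimodular i = trans (f-det2 (vec n i) (vec n (i ℤ.+ 1ℤ))) (unimod n i)

record UnimodularEdge (x y : Vertex) : Set where
  field
    source target : Pair
    source∼x      : SamePoint source (frac x)
    target∼y      : SamePoint target (frac y)
    unimodular    : det2 source target ≡ 𝟙

Adjacent⇒UnimodularEdge : ∀ {x y} → Adjacent x y → UnimodularEdge x y
Adjacent⇒UnimodularEdge {y = y} (a , b , (_ , a∼x) , (_ , b∼y) , ε-unit) = record
  { source = a
  ; target = conj ε *ₗ b
  ; source∼x = a∼x
  ; target∼y = SamePoint-*ₗ (conj ε) b (frac y) b∼y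
  ; unimodular = trans (det2-*ₗʳ (conj ε) a b) (trans (⊗-comm (conj ε) ε) (HasAbs1⇒⊗-conj≡𝟙 ε ε-unit))
  }
  where
  ε : ℤσ
  ε = det2 a b

-- The representative z of x is a multiple ℓ a of the source of the edge; ℓ is a unit because z is irreducible.
extendʳ : ∀ {x y} z → Represents z x → UnimodularEdge x y → Σ Pair λ z′ → Represents z′ y × det2 z z′ ≡ 𝟙
extendʳ {x} {y} z (z-irreducible , z∼x) e = conj ℓ *ₗ target ,
  (det2≡𝟙⇒Irreducibleʳ z (conj ℓ *ₗ target) unimodular′ , SamePoint-*ₗ (conj ℓ) target (frac y) target∼y) ,
  unimodular′
  where
  open UnimodularEdge e
  ℓ : ℤσ
  ℓ = det2 z target
  z≡ℓa : z ≡ ℓ *ₗ source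
  z≡ℓa = SamePoint⇒multipleˡ source target z unimodular
           (SamePoint-trans z (frac x) source (nonzero x) z∼x (SamePoint-sym source (frac x) source∼x))
  ℓ-unit : HasAbs1 ℓ
  ℓ-unit = proj₂ (subst Irreducible z≡ℓa z-irreducible) ℓ (proj₁ source , refl) (proj₂ source , refl)
  unimodular′ : det2 z (conj ℓ *ₗ target) ≡ 𝟙
  unimodular′ = trans (det2-*ₗʳ (conj ℓ) z target) (trans (⊗-comm (conj ℓ) ℓ) (HasAbs1⇒⊗-conj≡𝟙 ℓ ℓ-unit))

extendˡ : ∀ {x y} z → Represents z y → UnimodularEdge x y → Σ Pair λ z′ → Represents z′ x × det2 z′ z ≡ 𝟙
extendˡ {x} {y} z (z-irreducible , z∼y) e = conj ℓ *ₗ source ,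
  (det2≡𝟙⇒Irreducibleˡ (conj ℓ *ₗ source) z unimodular′ , SamePoint-*ₗ (conj ℓ) source (frac x) source∼x) ,
  unimodular′
  where
  open UnimodularEdge e
  ℓ : ℤσ
  ℓ = det2 source z
  z≡ℓb : z ≡ ℓ *ₗ target
  z≡ℓb = SamePoint⇒multipleʳ source target z unimodular
           (SamePoint-trans z (frac y) target (nonzero y) z∼y (SamePoint-sym target (frac y) target∼y))
  ℓ-unit : HasAbs1 ℓ
  ℓ-unit = proj₂ (subst Irreducible z≡ℓb z-irreducible) ℓ (proj₁ target , refl) (proj₂ target , refl)
  unimodular′ : det2 (conj ℓ *ₗ source) z ≡ 𝟙
  unimodular′ = trans (det2-*ₗˡ (conj ℓ) source z) (trans (⊗-comm (conj ℓ) ℓ) (HasAbs1⇒⊗-conj≡𝟙 ℓ ℓ-unit))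

normalisation : ∀ u → IsPath u → Normalisation u
normalisation u path = record
  { num = λ i → proj₁ (proj₁ (chosen i))
  ; den = λ i → proj₂ (proj₁ (chosen i))
  ; repr = λ i → proj₂ (chosen i)
  ; unimod = chain-related Related start step-suc step-pred
  }
  where
  Represented : ℤ → Set
  Represented i = Σ Pair λ z → Represents z (u i)
  Related : ∀ i → Represented i → Represented (i ℤ.+ 1ℤ) → Set
  Related i (z , _) (z′ , _) = det2 z z′ ≡ 𝟙
  edge : ∀ i → UnimodularEdge (u i) (u (i ℤ.+ 1ℤ))
  edge i = Adjacent⇒UnimodularEdge (path i)
  start : Represented 0ℤ
  start = source , det2≡𝟙⇒Irreducibleˡ source target unimodular , source∼x
    where
    open UnimodularEdge (edge 0ℤ)
  step-suc : ∀ i (s : Represented i) → Σ (Represented (i ℤ.+ 1ℤ)) (Related i s)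
  step-suc i (z , z-represents) = let (z′ , z′-represents , det≡𝟙) = extendʳ z z-represents (edge i)
                                  in (z′ , z′-represents) , det≡𝟙
  step-pred : ∀ i (s : Represented (i ℤ.+ 1ℤ)) → Σ (Represented i) λ s′ → Related i s′ s
  step-pred i (z , z-represents) = let (z′ , z′-represents , det≡𝟙) = extendˡ z z-represents (edge i)
                                   in (z′ , z′-represents) , det≡𝟙
  chosen : ∀ i → Represented i
  chosen = chain Related start step-suc step-pred

module _ (x : ℤ → Pair) (x-unimodular : Unimodular x) where

  private
    irreducible : ∀ i → Irreducible (x i)
    irreducible i = det2≡𝟙⇒Irreducibleˡ (x i) (x (i ℤ.+ 1ℤ)) (x-unimodular i)

  unimodular-path : Seq
  unimodular-path i = vtx (x i) (proj₁ (irreducible i))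

  unimodular-path-isPath : IsPath unimodular-path
  unimodular-path-isPath i = x i , x (i ℤ.+ 1ℤ) , (irreducible i , refl) , (irreducible (i ℤ.+ 1ℤ) , refl) ,
                             cong normSq (x-unimodular i)

  unimodular-path-normalisation : Normalisation unimodular-path
  unimodular-path-normalisation = record
    { num = λ i → proj₁ (x i)
    ; den = λ i → proj₂ (x i)
    ; repr = λ i → irreducible i , refl
    ; unimod = x-unimodular
    }

scalar-isTameSL₂Tiling : ∀ {u v} (nu : Normalisation u) (nv : Normalisation v) → IsTameSL₂Tiling (scalar nu nv)
scalar-isTameSL₂Tiling nu nv = scalarTiling-isTameSL₂Tiling (vec nu) (vec nv) (unimod nu) (unimod nv)

scalar-rescale : ∀ {u v} k l (nu : Normalisation u) (nv : Normalisation v) i j →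
  vec (rescale k nu) i · vec (rescale l nv) j ≡ σ^ (alt i k ℤ.+ alt j l) ⊗ (vec nu i · vec nv j)
scalar-rescale k l nu nv i j =
  trans (·-*ₗ (σ^ (alt i k)) (σ^ (alt j l)) (vec nu i) (vec nv j))
        (cong (_⊗ (vec nu i · vec nv j)) (sym (σ^-+ (alt i k) (alt j l))))

≡⇒TilingEquiv : ∀ {m m′} → (∀ i j → m′ i j ≡ m i j) → TilingEquiv m m′
≡⇒TilingEquiv {m} m′≡m = 0ℤ , 0ℤ , λ i j → begin
  _                               ≡⟨ m′≡m i j ⟩
  m i j                           ≡⟨ sym (⊗-identityˡ (m i j)) ⟩
  σ^ (0ℤ ℤ.+ 0ℤ) ⊗ m i j          ≡⟨ cong (λ t → σ^ t ⊗ m i j) (sym (cong₂ ℤ._+_ (alt-zero i) (alt-zero j))) ⟩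
  σ^ (alt i 0ℤ ℤ.+ alt j 0ℤ) ⊗ m i j ∎

scalar-respects-PairEquiv : ∀ {u v u′ v′} → PairEquiv u v u′ v′ →
  (nu : Normalisation u) (nv : Normalisation v) (nu′ : Normalisation u′) (nv′ : Normalisation v′) →
  TilingEquiv (scalar nu nv) (scalar nu′ nv′)
scalar-respects-PairEquiv {u′ = u′} {v′ = v′} (A , Au∼u′ , A⁻ᵀv∼v′) nu nv nu′ nv′ =
  let (k , nu′≡k·Anu) = Normalisation-unique Anu nu′
      (l , nv′≡l·A⁻ᵀnv) = Normalisation-unique A⁻ᵀnv nv′
  in k , l , λ i j → begin
    vec nu′ i · vec nv′ j                                   ≡⟨ cong₂ _·_ (nu′≡k·Anu i) (nv′≡l·A⁻ᵀnv j) ⟩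
    vec (rescale k Anu) i · vec (rescale l A⁻ᵀnv) j         ≡⟨ scalar-rescale k l Anu A⁻ᵀnv i j ⟩
    σ^ (alt i k ℤ.+ alt j l) ⊗ (vec Anu i · vec A⁻ᵀnv j)    ≡⟨ cong (σ^ (alt i k ℤ.+ alt j l) ⊗_)
                                                                  (act-·-actInvT A (vec nu i) (vec nv j)) ⟩
    σ^ (alt i k ℤ.+ alt j l) ⊗ (vec nu i · vec nv j)        ∎
  where
  Anu : Normalisation u′
  Anu = Normalisation-map (act A) (det2-act A) Au∼u′ nu
  A⁻ᵀnv : Normalisation v′
  A⁻ᵀnv = Normalisation-map (actInvT A) (det2-actInvT A) A⁻ᵀv∼v′ nv

det2-preserving⇒mapsPoint : ∀ {u u′} (f : Pair → Pair) → (∀ x y → det2 (f x) (f y) ≡ det2 x y) →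
  (n : Normalisation u) (n′ : Normalisation u′) → ∀ i → f (vec n i) ≡ vec n′ i → SamePoint (f (frac (u i))) (frac (u′ i))
det2-preserving⇒mapsPoint {u} {u′} f f-det2 n n′ i f[n]≡n′ =
  SamePoint-trans (f (frac (u i))) (vec n′ i) (frac (u′ i)) (proj₁ (proj₁ (repr n′ i)))
    (subst (SamePoint (f (frac (u i)))) f[n]≡n′
      (det2-preserving⇒SamePoint f f-det2 (frac (u i)) (vec n i) (SamePoint-sym (vec n i) (frac (u i)) (proj₂ (repr n i)))))
    (proj₂ (repr n′ i))

TilingEquiv⇒PairEquiv : ∀ {u v u′ v′}
  (nu : Normalisation u) (nv : Normalisation v) (nu′ : Normalisation u′) (nv′ : Normalisation v′) →
  TilingEquiv (scalar nu nv) (scalar nu′ nv′) → PairEquiv u v u′ v′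
TilingEquiv⇒PairEquiv nu nv nu′ nv′ (k , l , m′≡σm) =
  let (A , maps-u , maps-v) = scalar-injective (vec (rescale k nu)) (vec (rescale l nv)) (vec nu′) (vec nv′)
                                (unimod (rescale k nu) 0ℤ) (unimod nu′ 0ℤ) (unimod nv′ 0ℤ)
                                (λ i j → trans (scalar-rescale k l nu nv i j) (sym (m′≡σm i j)))
  in A , (λ i → det2-preserving⇒mapsPoint (act A) (det2-act A) (rescale k nu) nu′ i (maps-u i)) ,
         (λ j → det2-preserving⇒mapsPoint (actInvT A) (det2-actInvT A) (rescale l nv) nv′ j (maps-v j))

tame⇒scalar : ∀ m → IsTameSL₂Tiling m →
  Σ Seq λ u → Σ Seq λ v → IsPath u × IsPath v ×
  Σ (Normalisation u) λ nu → Σ (Normalisation v) λ nv → TilingEquiv m (scalar nu nv)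
tame⇒scalar m m-tame =
  let (x , y , x-unimodular , y-unimodular , x·y≡m) = tame-decomposition m m-tame
  in unimodular-path x x-unimodular , unimodular-path y y-unimodular ,
     unimodular-path-isPath x x-unimodular , unimodular-path-isPath y y-unimodular ,
     unimodular-path-normalisation x x-unimodular , unimodular-path-normalisation y y-unimodular ,
     ≡⇒TilingEquiv x·y≡m

theorem5p18 :
  -- every path admits a normalisation (so the map is defined)
  (∀ (u : Seq) → IsPath u → Normalisation u)
  -- the scalar product of normalised paths is a tame SL₂-tiling
  × (∀ (u v : Seq) → IsPath u → IsPath v →
       (nu : Normalisation u) (nv : Normalisation v) →
       IsTameSL₂Tiling (scalar nu nv))
  -- well defined on classes (independent of normalisations and of the action)
  × (∀ (u v u' v' : Seq) → IsPath u → IsPath v → IsPath u' → IsPath v' →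
       PairEquiv u v u' v' →
       (nu : Normalisation u) (nv : Normalisation v)
       (nu' : Normalisation u') (nv' : Normalisation v') →
       TilingEquiv (scalar nu nv) (scalar nu' nv'))
  -- injective on classes
  × (∀ (u v u' v' : Seq) → IsPath u → IsPath v → IsPath u' → IsPath v' →
       (nu : Normalisation u) (nv : Normalisation v)
       (nu' : Normalisation u') (nv' : Normalisation v') →
       TilingEquiv (scalar nu nv) (scalar nu' nv') →
       PairEquiv u v u' v')
  -- surjective onto classes of tame tilings
  × (∀ (m : Matrix) → IsTameSL₂Tiling m →
       Σ Seq λ u → Σ Seq λ v → IsPath u × IsPath v ×
       Σ (Normalisation u) λ nu → Σ (Normalisation v) λ nv →
       TilingEquiv m (scalar nu nv))
theorem5p18 =
  normalisation ,
  (λ _ _ _ _ → scalar-isTameSL₂Tiling) ,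
  (λ _ _ _ _ _ _ _ _ → scalar-respects-PairEquiv) ,
  (λ _ _ _ _ _ _ _ _ → TilingEquiv⇒PairEquiv) ,
  tame⇒scalar
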